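{- Let $\ell\geq s\geq r\geq 3$ be integers. Then for all sufficiently large $n$, $$\mathrm{ex}_r(n,K_s^{(r)},\mathcal{K}_{\ell+1}^r)=\mathcal{N}(K_s^{(r)},\mathcal{T}_r(n,\ell)).$$
   Context: An $r$-graph is a hypergraph all of whose hyperedges have exactly $r$ vertices. $K_s^{(r)}$ is the complete $r$-graph on $s$ vertices. For $t>r$, $\mathcal{K}_t^r$ is the family of all $r$-graphs $\mathcal{F}$ with at most $\binom{t}{2}$ hyperedges for which there is a set $S$ of $t$ vertices such that every pair of vertices of $S$ is contained in some hyperedge of $\mathcal{F}$. $\mathrm{ex}_r(n,K_s^{(r)},\mathcal{K}_t^r)$ is the maximum number of copies of $K_s^{(r)}$ in an $n$-vertex $r$-graph containing no subhypergraph isomorphic to any member of $\mathcal{K}_t^r$. $\mathcal{T}_r(n,\ell)$ is the complete balanced $\ell$-partite $r$-graph on $n$ vertices: vertex set partitioned into $\ell$ parts of sizes differing by at most one, hyperedges all $r$-sets meeting each part in at most one vertex. $\mathcal{N}(\mathcal{G}_1,\mathcal{G}_2)$ is the number of copies of $\mathcal{G}_1$ in $\mathcal{G}_2$. -}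

module Defs where

open import Data.Bool using (Bool; true; false; _∧_; _∨_; not; T; if_then_else_)
open import Data.Nat using (ℕ; zero; suc; _≤_; _%_; _≡ᵇ_)
open import Data.Nat.Combinatorics using (_C_)
open import Data.Fin using (Fin; toℕ; _≟_)
open import Data.Fin.Subset using (Subset; _∈_; ∣_∣; inside; outside)
open import Data.Vec using (Vec; []; _∷_; lookup)
open import Data.List using (List; []; _∷_; map; _++_; length; filterᵇ; allFin)
open import Data.Bool.ListAction using (all)
open import Data.Product using (Σ; ∃; _×_; _,_; proj₁)
open import Relation.Nullary using (¬_; does)
open import Relation.Binary.PropositionalEquality using (_≡_; _≢_; refl; cong)
open import Data.Unit using (tt)

allSubsets : (n : ℕ) → List (Subset n)
allSubsets zero = [] ∷ []
allSubsets (suc n) = map (outside ∷_) (allSubsets n) ++ map (inside ∷_) (allSubsets n)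

countSubsets : {n : ℕ} → (Subset n → Bool) → ℕ
countSubsets {n} p = length (filterᵇ p (allSubsets n))

_⊆ᵇ_ : {n : ℕ} → Subset n → Subset n → Bool
[] ⊆ᵇ [] = true
(false ∷ a) ⊆ᵇ (_ ∷ b) = a ⊆ᵇ b
(true ∷ a) ⊆ᵇ (true ∷ b) = a ⊆ᵇ b
(true ∷ a) ⊆ᵇ (false ∷ b) = false

_⇒ᵇ_ : Bool → Bool → Bool
a ⇒ᵇ b = not a ∨ b

RGraph : ℕ → ℕ → Set
RGraph n r = Σ (Subset n → Bool) (λ E → ∀ A → T (E A) → ∣ A ∣ ≡ r)

edge : {n r : ℕ} → RGraph n r → Subset n → Bool
edge = proj₁

spansClique : {n r : ℕ} → (s : ℕ) → RGraph n r → Subset n → Bool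
spansClique {n} {r} s H S =
  (∣ S ∣ ≡ᵇ s) ∧ all (λ B → ((B ⊆ᵇ S) ∧ (∣ B ∣ ≡ᵇ r)) ⇒ᵇ edge H B) (allSubsets n)

-- N(K_s^(r), H): number of copies of K_s^(r) in H
-- (a copy of K_s^(r) is determined by its vertex set).
numCliques : {n r : ℕ} → (s : ℕ) → RGraph n r → ℕ
numCliques s H = countSubsets (spansClique s H)

-- H contains a subhypergraph isomorphic to a member of 𝒦_t^r:
-- there is a subfamily F of the hyperedges of H with at most (t choose 2)
-- hyperedges and a set S of t vertices each pair of which lies in a hyperedge of F.
ContainsKt : {n r : ℕ} → (t : ℕ) → RGraph n r → Set
ContainsKt {n} t H =
  ∃ λ (F : Subset n → Bool) →
    (∀ A → T (F A) → T (edge H A)) ×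
    countSubsets F ≤ t C 2 ×
    ∃ λ (S : Subset n) → ∣ S ∣ ≡ t ×
      (∀ x y → x ∈ S → y ∈ S → x ≢ y → ∃ λ A → T (F A) × x ∈ A × y ∈ A)

-- Part of vertex i in the balanced ℓ-partition of Fin n (residue of i mod ℓ;
-- parts sizes then differ by at most one). The ℓ = 0 case is never used.
part : {n : ℕ} → ℕ → Fin n → ℕ
part zero i = toℕ i
part (suc k) i = toℕ i % suc k

turanEdge : {n : ℕ} → ℕ → ℕ → Subset n → Bool
turanEdge {n} r ℓ A =
  (∣ A ∣ ≡ᵇ r) ∧
  all (λ x → all (λ y →
         ((lookup A x ∧ lookup A y) ∧ not (does (x ≟ y))) ⇒ᵇ not (part ℓ x ≡ᵇ part ℓ y))
       (allFin n)) (allFin n)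

≡ᵇ⇒≡ : (a b : ℕ) → T (a ≡ᵇ b) → a ≡ b
≡ᵇ⇒≡ zero zero _ = refl
≡ᵇ⇒≡ (suc a) (suc b) p = cong suc (≡ᵇ⇒≡ a b p)

T∧ˡ : (a b : Bool) → T (a ∧ b) → T a
T∧ˡ true b _ = tt

turan : (n r ℓ : ℕ) → RGraph n r
turan n r ℓ = turanEdge r ℓ , λ A p → ≡ᵇ⇒≡ ∣ A ∣ r (T∧ˡ _ _ p)

IsEx : (r n s t m : ℕ) → Set
IsEx r n s t m =
  (∀ (H : RGraph n r) → ¬ ContainsKt t H → numCliques s H ≤ m) ×
  (∃ λ (H : RGraph n r) → ¬ ContainsKt t H × numCliques s H ≡ m)

-- For 2 ≤ r ≤ s every s-clique of an r-graph H is an s-clique of its shadow graph (pairs covered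
-- by a hyperedge), and an (ℓ + 1)-clique of the shadow, with one chosen hyperedge per pair, would
-- be a member of 𝒦_{ℓ+1}^r inside H. It therefore suffices that a K_{ℓ+1}-free graph on n vertices
-- has at most e_s(n₁, …, n_ℓ) s-cliques, e_s the elementary symmetric polynomial and n₁, …, n_ℓ
-- the part sizes of a balanced ℓ-partition of the vertices (Zykov symmetrisation, by induction on ℓ),
-- while every s-clique of the Turán graph spans a copy of K_s^(r) in 𝒯_r(n, ℓ), which itself
-- contains no member of 𝒦_{ℓ+1}^r. This holds for every n, so N = 0 works.

{-# OPTIONS --safe #-}
module Submission where

open import Defs
open import Algebra.Bundles using (CommutativeMonoid)
open import Data.Bool using (Bool; true; false; _∧_; _∨_; not; T; if_then_else_)
open import Data.Bool.ListAction using (all)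
open import Data.Bool.Properties using (T-≡; T-not-≡; ∧-commutativeMonoid) renaming (_≟_ to _≟ᵇ_)
open import Data.Empty using (⊥-elim)
open import Data.Fin using (Fin; zero; suc; toℕ; fromℕ<; _≟_)
open import Data.Fin.Properties using (any?; toℕ-injective; toℕ-fromℕ<; toℕ-fromℕ; toℕ-inject₁; toℕ<n)
open import Data.Fin.Subset using (Subset; ∣_∣; inside; outside; _∈_; _∉_; _⊆_; ⊥; ⁅_⁆; Empty; Nonempty)
open import Data.Fin.Subset.Properties
  using (nonempty?; Empty-unique; ∣⊥∣≡0; ∉⊥; drop-∷-⊆; s⊆s; out⊆; x∈⁅x⁆; x∈⁅y⁆⇒x≡y; ∣⁅x⁆∣≡1)
open import Data.List as List using (List; []; _∷_; _++_; length; filterᵇ; allFin)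
open import Data.List.Membership.Propositional using () renaming (_∈_ to _∈ₗ_)
open import Data.List.Membership.Propositional.Properties using (∈-allFin; ∈-++⁺ˡ; ∈-++⁺ʳ; ∈-map⁺)
open import Data.List.Properties using (length-++; filter-++)
open import Data.List.Relation.Unary.All as All using ()
open import Data.List.Relation.Unary.All.Properties using (all⁺; all⁻)
open import Data.List.Relation.Unary.Any using (here)
open import Data.Nat using (ℕ; zero; suc; pred; >-nonZero; _+_; _*_; _∸_; _≤_; _<_; z≤n; s≤s; s≤s⁻¹; _≡ᵇ_; _<ᵇ_)
open import Data.Nat.Combinatorics using (nC1≡n; nCk+nC[k+1]≡[n+1]C[k+1]) renaming (_C_ to _choose_)
open import Data.Nat.DivMod using (_%_; _/_; m%n<n; m≡m%n+[m/n]*n; [m+kn]%n≡m%n; m<n⇒m%n≡m; n%n≡0)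
open import Data.Nat.Induction using (<-wellFounded)
open import Data.Nat.Properties hiding (_≟_; ≡ᵇ⇒≡)
open import Algebra.Properties.CommutativeMonoid.Sum +-0-commutativeMonoid using (sum; sum-cong-≗; sum-init-last)
open import Algebra.Properties.CommutativeSemigroup +-commutativeSemigroup
  using () renaming (interchange to +-interchange)
open import Algebra.Properties.CommutativeSemigroup (CommutativeMonoid.commutativeSemigroup ∧-commutativeMonoid)
  using () renaming (xy∙z≈xz∙y to ∧-swapʳ)
open import Data.Nat.Tactic.RingSolver using (solve-∀)
open import Data.Product using (∃; _×_; _,_; proj₁; proj₂)
open import Data.Sum using (_⊎_; inj₁; inj₂; [_,_]′)
open import Data.Unit using (tt)
open import Data.Vec using ([]; _∷_; lookup; _[_]≔_; here; there)
open import Data.Vec.Functional using (updateAt) renaming (_∷_ to _∷ᶠ_)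
open import Data.Vec.Functional.Properties using (updateAt-updates; updateAt-minimal; updateAt-updateAt)
open import Data.Vec.Properties
  using (≡-dec; lookup∘updateAt′; []=⇒lookup; lookup⇒[]=; []=-injective; []≔-updates; []≔-minimal)
open import Function using (_∘_; id; const; Equivalence)
import Induction.WellFounded as WF
open import Level using (0ℓ)
import Relation.Binary.Construct.On as On
open import Relation.Binary.PropositionalEquality
open import Relation.Nullary using (¬_; Dec; yes; no; does)
open import Relation.Nullary.Decidable using (T?; dec-true; dec-false)

T-∧⁺ : {a b : Bool} → T a → T b → T (a ∧ b)
T-∧⁺ {true} {true} _ _ = tt

T-∧⁻ˡ : {a b : Bool} → T (a ∧ b) → T a
T-∧⁻ˡ {true} _ = tt

T-∧⁻ʳ : {a b : Bool} → T (a ∧ b) → T b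
T-∧⁻ʳ {true} p = p

T-∨⁺ˡ : {a b : Bool} → T a → T (a ∨ b)
T-∨⁺ˡ {true} _ = tt

T-∨⁺ʳ : {a b : Bool} → T b → T (a ∨ b)
T-∨⁺ʳ {true} _ = tt
T-∨⁺ʳ {false} p = p

T-∨⁻ : {a b : Bool} → T (a ∨ b) → T a ⊎ T b
T-∨⁻ {true} _ = inj₁ tt
T-∨⁻ {false} p = inj₂ p

T-not⁺ : {a : Bool} → ¬ T a → T (not a)
T-not⁺ {false} _ = tt
T-not⁺ {true} ¬a = ¬a tt

T-not⁻ : {a : Bool} → T (not a) → ¬ T a
T-not⁻ {false} _ ()

T-⇒ᵇ⁺ : {a b : Bool} → (T a → T b) → T (a ⇒ᵇ b)
T-⇒ᵇ⁺ {false} _ = tt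
T-⇒ᵇ⁺ {true} f = f tt

T-⇒ᵇ⁻ : {a b : Bool} → T (a ⇒ᵇ b) → T a → T b
T-⇒ᵇ⁻ {true} p _ = p

T-all⁻ : {A : Set} (p : A → Bool) {xs : List A} → T (all p xs) → ∀ {x} → x ∈ₗ xs → T (p x)
T-all⁻ p {xs} h = All.lookup (all⁺ p xs h)

T-all⁺ : {A : Set} (p : A → Bool) (xs : List A) → (∀ x → T (p x)) → T (all p xs)
T-all⁺ p xs f = all⁻ p {xs} (All.tabulate (λ {x} _ → f x))

T-allFin⁻ : {n : ℕ} (p : Fin n → Bool) → T (all p (allFin n)) → ∀ x → T (p x)
T-allFin⁻ p h x = T-all⁻ p h (∈-allFin x)

≢⇒≟-false : {n : ℕ} (x y : Fin n) → x ≢ y → T (not (does (x ≟ y)))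
≢⇒≟-false x y x≢y = Equivalence.from T-not-≡ (dec-false (x ≟ y) x≢y)

≟-false⇒≢ : {n : ℕ} (x y : Fin n) → T (not (does (x ≟ y))) → x ≢ y
≟-false⇒≢ x y h x≡y = T-not⁻ h (Equivalence.from T-≡ (dec-true (x ≟ y) x≡y))

indicator : Bool → ℕ
indicator b = if b then 1 else 0

count : {n : ℕ} → (Fin n → Bool) → ℕ
count p = sum (λ i → indicator (p i))

count-mono : {n : ℕ} {p q : Fin n → Bool} → (∀ i → T (p i) → T (q i)) → count p ≤ count q
count-mono {zero} p⊆q = z≤n
count-mono {suc n} p⊆q = +-mono-≤ (indicator-mono (p⊆q zero)) (count-mono (p⊆q ∘ suc))
  where
  indicator-mono : {a b : Bool} → (T a → T b) → indicator a ≤ indicator b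
  indicator-mono {false} _ = z≤n
  indicator-mono {true} {true} _ = ≤-refl
  indicator-mono {true} {false} f = ⊥-elim (f tt)

count-cong : {n : ℕ} {p q : Fin n → Bool} →
  (∀ i → T (p i) → T (q i)) → (∀ i → T (q i) → T (p i)) → count p ≡ count q
count-cong p⊆q q⊆p = ≤-antisym (count-mono p⊆q) (count-mono q⊆p)

count-cong-≗ : {n : ℕ} {p q : Fin n → Bool} → (∀ i → p i ≡ q i) → count p ≡ count q
count-cong-≗ p≗q = sum-cong-≗ (cong indicator ∘ p≗q)

count-none : {n : ℕ} (p : Fin n → Bool) → (∀ i → ¬ T (p i)) → count p ≡ 0
count-none {zero} p none = refl
count-none {suc n} p none with p zero | none zero
... | true | ¬p0 = ⊥-elim (¬p0 tt)
... | false | _ = count-none (p ∘ suc) (none ∘ suc)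

count-all : (n : ℕ) → count {n} (λ _ → true) ≡ n
count-all zero = refl
count-all (suc n) = cong suc (count-all n)

_∖_ : {n : ℕ} → (Fin n → Bool) → Fin n → Fin n → Bool
(U ∖ u) x = U x ∧ not (does (x ≟ u))

_∩_ : {n : ℕ} → (Fin n → Bool) → (Fin n → Bool) → Fin n → Bool
(U ∩ V) x = U x ∧ V x

count-∖ : {n : ℕ} (U : Fin n → Bool) {u : Fin n} → T (U u) → count U ≡ suc (count (U ∖ u))
count-∖ {suc n} U {zero} Uu with U zero
... | true = cong suc (count-cong {p = U ∘ suc} {q = λ i → U (suc i) ∧ true} (λ _ Ui → T-∧⁺ Ui tt) (λ _ → T-∧⁻ˡ))
count-∖ {suc n} U {suc u} Uu with U zero
... | true = cong suc (count-∖ (U ∘ suc) Uu)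
... | false = count-∖ (U ∘ suc) Uu

count-∖-< : {n : ℕ} (U : Fin n → Bool) {u : Fin n} → T (U u) → count (U ∖ u) < count U
count-∖-< U Uu = ≤-reflexive (sym (count-∖ U Uu))

count-⊂ : {n : ℕ} {A W : Fin n → Bool} {u : Fin n} →
  (∀ {x} → T (A x) → T (W x)) → T (W u) → ¬ T (A u) → count A < count W
count-⊂ {W = W} {u} A⊆W Wu ¬Au = ≤-<-trans
  (count-mono λ x Ax → T-∧⁺ (A⊆W Ax) (≢⇒≟-false x u λ { refl → ¬Au Ax }))
  (count-∖-< W Wu)

count-rec : {n : ℕ} (P : (Fin n → Bool) → Set) →
  (∀ U → (∀ {V} → count V < count U → P V) → P U) → ∀ U → P U
count-rec P = WF.All.wfRec (On.wellFounded count <-wellFounded) 0ℓ P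

argmax : {n : ℕ} (U : Fin n → Bool) (g : Fin n → ℕ) →
  (∀ x → ¬ T (U x)) ⊎ ∃ λ v → T (U v) × (∀ {u} → T (U u) → g u ≤ g v)
argmax {zero} U g = inj₁ (λ ())
argmax {suc n} U g with argmax (U ∘ suc) (g ∘ suc) | T? (U zero)
... | inj₁ ∄x | no ¬U0 = inj₁ λ { zero → ¬U0 ; (suc x) → ∄x x }
... | inj₁ ∄x | yes U0 = inj₂ (zero , U0 , λ { {zero} _ → ≤-refl ; {suc x} Ux → ⊥-elim (∄x x Ux) })
... | inj₂ (v , Uv , max) | no ¬U0 = inj₂ (suc v , Uv , λ { {zero} U0 → ⊥-elim (¬U0 U0) ; {suc _} Ux → max Ux })
... | inj₂ (v , Uv , max) | yes U0 with g (suc v) ≤? g zero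
...   | yes gv≤g0 = inj₂ (zero , U0 , λ { {zero} _ → ≤-refl ; {suc _} Ux → ≤-trans (max Ux) gv≤g0 })
...   | no gv≰g0 = inj₂ (suc v , Uv , λ { {zero} _ → <⇒≤ (≰⇒> gv≰g0) ; {suc _} Ux → max Ux })

count-toℕ-suc : (f : ℕ → Bool) (m : ℕ) → count {suc m} (f ∘ toℕ) ≡ count {m} (f ∘ toℕ) + indicator (f m)
count-toℕ-suc f m = trans (sum-init-last {m} (λ i → indicator (f (toℕ i))))
  (cong₂ _+_ (sum-cong-≗ {m} (λ i → cong (indicator ∘ f) (toℕ-inject₁ i)))
             (cong (indicator ∘ f) (toℕ-fromℕ m)))

anyFin : {m : ℕ} → (Fin m → Bool) → Bool
anyFin {zero} p = false
anyFin {suc m} p = p zero ∨ anyFin (p ∘ suc)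

anyFin⁺ : {m : ℕ} (p : Fin m → Bool) (i : Fin m) → T (p i) → T (anyFin p)
anyFin⁺ p zero pi = T-∨⁺ˡ pi
anyFin⁺ p (suc i) pi = T-∨⁺ʳ {p zero} (anyFin⁺ (p ∘ suc) i pi)

≤-sum : {ℓ : ℕ} (P : Fin ℓ → ℕ) (k : Fin ℓ) → P k ≤ sum P
≤-sum P zero = m≤m+n _ _
≤-sum P (suc k) = ≤-trans (≤-sum (P ∘ suc) k) (m≤n+m _ _)

sum-mono : {ℓ : ℕ} {P Q : Fin ℓ → ℕ} → (∀ k → P k ≤ Q k) → sum P ≤ sum Q
sum-mono {zero} _ = z≤n
sum-mono {suc ℓ} P≤Q = +-mono-≤ (P≤Q zero) (sum-mono (P≤Q ∘ suc))

sum-mono-< : {ℓ : ℕ} {P Q : Fin ℓ → ℕ} (i : Fin ℓ) → (∀ k → P k ≤ Q k) → P i < Q i → sum P < sum Q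
sum-mono-< {suc ℓ} zero P≤Q Pi<Qi = +-mono-<-≤ Pi<Qi (sum-mono (P≤Q ∘ suc))
sum-mono-< {suc ℓ} (suc i) P≤Q Pi<Qi = +-mono-≤-< (P≤Q zero) (sum-mono-< i (P≤Q ∘ suc) Pi<Qi)

sum-updateAt : {ℓ : ℕ} (P : Fin ℓ → ℕ) (i : Fin ℓ) (f : ℕ → ℕ) → sum (updateAt P i f) + P i ≡ sum P + f (P i)
sum-updateAt {suc ℓ} P zero f = solve (f (P zero)) (sum (P ∘ suc)) (P zero)
  where
  solve : ∀ a b c → (a + b) + c ≡ (c + b) + a
  solve = solve-∀
sum-updateAt {suc ℓ} P (suc i) f = begin
  (P zero + sum (updateAt (P ∘ suc) i f)) + P (suc i) ≡⟨ +-assoc (P zero) _ _ ⟩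
  P zero + (sum (updateAt (P ∘ suc) i f) + P (suc i)) ≡⟨ cong (P zero +_) (sum-updateAt (P ∘ suc) i f) ⟩
  P zero + (sum (P ∘ suc) + f (P (suc i)))            ≡⟨ +-assoc (P zero) _ _ ⟨
  (P zero + sum (P ∘ suc)) + f (P (suc i))            ∎
  where open ≡-Reasoning

_≟ₛ_ : {n : ℕ} (A B : Subset n) → Dec (A ≡ B)
_≟ₛ_ = ≡-dec _≟ᵇ_

∈⇒T : {n : ℕ} {p : Subset n} {x : Fin n} → x ∈ p → T (lookup p x)
∈⇒T x∈p rewrite []=⇒lookup x∈p = tt

T⇒∈ : {n : ℕ} {p : Subset n} {x : Fin n} → T (lookup p x) → x ∈ p
T⇒∈ {p = p} {x} t = lookup⇒[]= x p (Equivalence.to T-≡ t)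

∣p∣≡count : {n : ℕ} (p : Subset n) → ∣ p ∣ ≡ count (lookup p)
∣p∣≡count [] = refl
∣p∣≡count (false ∷ p) = ∣p∣≡count p
∣p∣≡count (true ∷ p) = cong suc (∣p∣≡count p)

∣p∣≡0⇒Empty : {n : ℕ} {p : Subset n} → ∣ p ∣ ≡ 0 → Empty p
∣p∣≡0⇒Empty {p = outside ∷ p} ∣p∣≡0 (suc x , there x∈p) = ∣p∣≡0⇒Empty ∣p∣≡0 (x , x∈p)

∣p∣≢0⇒Nonempty : {n : ℕ} {p : Subset n} → ∣ p ∣ ≢ 0 → Nonempty p
∣p∣≢0⇒Nonempty {n} {p} ∣p∣≢0 with nonempty? p
... | yes nonempty = nonempty
... | no empty = ⊥-elim (∣p∣≢0 (trans (cong ∣_∣ (Empty-unique empty)) (∣⊥∣≡0 n)))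

∈-[]≔⁻ : {n : ℕ} {p : Subset n} {x y : Fin n} {b : Bool} → y ≢ x → y ∈ p [ x ]≔ b → y ∈ p
∈-[]≔⁻ {p = p} {x} {y} y≢x y∈ = lookup⇒[]= y p (trans (sym (lookup∘updateAt′ y x y≢x p)) ([]=⇒lookup y∈))

∈-[]≔⁺ : {n : ℕ} {p : Subset n} {x y : Fin n} {b : Bool} → y ≢ x → y ∈ p → y ∈ p [ x ]≔ b
∈-[]≔⁺ {p = p} {x} {y} y≢x = []≔-minimal p y x y≢x

x∉p[x]≔outside : {n : ℕ} (p : Subset n) (x : Fin n) → x ∉ p [ x ]≔ outside
x∉p[x]≔outside p x x∈ with () ← []=-injective x∈ ([]≔-updates p x)

p[x]≔outside⊆p : {n : ℕ} {p : Subset n} {x : Fin n} → p [ x ]≔ outside ⊆ p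
p[x]≔outside⊆p {p = p} {x} {y} y∈ = ∈-[]≔⁻ (λ { refl → x∉p[x]≔outside p x y∈ }) y∈

∈-[]≔inside⁻ : {n : ℕ} {p : Subset n} {x y : Fin n} → y ∈ p [ x ]≔ inside → y ≡ x ⊎ y ∈ p
∈-[]≔inside⁻ {x = x} {y} y∈ with y ≟ x
... | yes y≡x = inj₁ y≡x
... | no y≢x = inj₂ (∈-[]≔⁻ y≢x y∈)

∣p[x]≔inside∣ : {n : ℕ} (p : Subset n) {x : Fin n} → x ∉ p → ∣ p [ x ]≔ inside ∣ ≡ suc ∣ p ∣
∣p[x]≔inside∣ (outside ∷ p) {zero} _ = refl
∣p[x]≔inside∣ (inside ∷ p) {zero} x∉p = ⊥-elim (x∉p here)
∣p[x]≔inside∣ (outside ∷ p) {suc x} x∉p = ∣p[x]≔inside∣ p (x∉p ∘ there)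
∣p[x]≔inside∣ (inside ∷ p) {suc x} x∉p = cong suc (∣p[x]≔inside∣ p (x∉p ∘ there))

∣p[x]≔outside∣ : {n : ℕ} (p : Subset n) {x : Fin n} → x ∈ p → suc ∣ p [ x ]≔ outside ∣ ≡ ∣ p ∣
∣p[x]≔outside∣ (inside ∷ p) here = refl
∣p[x]≔outside∣ (outside ∷ p) (there x∈p) = ∣p[x]≔outside∣ p x∈p
∣p[x]≔outside∣ (inside ∷ p) (there x∈p) = cong suc (∣p[x]≔outside∣ p x∈p)

⊆ᵇ⇒⊆ : {n : ℕ} {p q : Subset n} → T (p ⊆ᵇ q) → p ⊆ q
⊆ᵇ⇒⊆ {p = inside ∷ p} {inside ∷ q} _ here = here
⊆ᵇ⇒⊆ {p = outside ∷ p} {_ ∷ q} p⊆q (there x∈p) = there (⊆ᵇ⇒⊆ p⊆q x∈p)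
⊆ᵇ⇒⊆ {p = inside ∷ p} {inside ∷ q} p⊆q (there x∈p) = there (⊆ᵇ⇒⊆ p⊆q x∈p)

⊆⇒⊆ᵇ : {n : ℕ} {p q : Subset n} → p ⊆ q → T (p ⊆ᵇ q)
⊆⇒⊆ᵇ {p = []} {[]} _ = tt
⊆⇒⊆ᵇ {p = outside ∷ p} {_ ∷ q} p⊆q = ⊆⇒⊆ᵇ (drop-∷-⊆ p⊆q)
⊆⇒⊆ᵇ {p = inside ∷ p} {inside ∷ q} p⊆q = ⊆⇒⊆ᵇ (drop-∷-⊆ p⊆q)
⊆⇒⊆ᵇ {p = inside ∷ p} {outside ∷ q} p⊆q with () ← p⊆q here

⊆-extend : {n : ℕ} (p q : Subset n) (k : ℕ) → p ⊆ q → ∣ p ∣ ≤ k → k ≤ ∣ q ∣ →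
  ∃ λ r → p ⊆ r × r ⊆ q × ∣ r ∣ ≡ k
⊆-extend [] [] zero _ _ _ = [] , id , id , refl
⊆-extend (inside ∷ p) (outside ∷ q) k p⊆q _ _ with () ← p⊆q here
⊆-extend (inside ∷ p) (inside ∷ q) (suc k) p⊆q (s≤s ∣p∣≤k) (s≤s k≤∣q∣)
  with r , p⊆r , r⊆q , ∣r∣≡k ← ⊆-extend p q k (drop-∷-⊆ p⊆q) ∣p∣≤k k≤∣q∣
  = inside ∷ r , s⊆s p⊆r , s⊆s r⊆q , cong suc ∣r∣≡k
⊆-extend (outside ∷ p) (outside ∷ q) k p⊆q ∣p∣≤k k≤∣q∣
  with r , p⊆r , r⊆q , ∣r∣≡k ← ⊆-extend p q k (drop-∷-⊆ p⊆q) ∣p∣≤k k≤∣q∣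
  = outside ∷ r , s⊆s p⊆r , s⊆s r⊆q , ∣r∣≡k
⊆-extend (outside ∷ p) (inside ∷ q) k p⊆q ∣p∣≤k k≤1+∣q∣ with k ≤? ∣ q ∣
... | yes k≤∣q∣ with r , p⊆r , r⊆q , ∣r∣≡k ← ⊆-extend p q k (drop-∷-⊆ p⊆q) ∣p∣≤k k≤∣q∣
  = outside ∷ r , s⊆s p⊆r , out⊆ r⊆q , ∣r∣≡k
... | no k≰∣q∣ = inside ∷ q , out⊆ (drop-∷-⊆ p⊆q) , id , ≤-antisym (≰⇒> k≰∣q∣) k≤1+∣q∣

pair : {n : ℕ} → Fin n → Fin n → Subset n
pair x y = ⁅ x ⁆ [ y ]≔ inside

x∈pair : {n : ℕ} {x y : Fin n} → x ≢ y → x ∈ pair x y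
x∈pair {x = x} x≢y = ∈-[]≔⁺ x≢y (x∈⁅x⁆ x)

y∈pair : {n : ℕ} (x y : Fin n) → y ∈ pair x y
y∈pair x y = []≔-updates ⁅ x ⁆ y

pair⊆ : {n : ℕ} {x y : Fin n} {p : Subset n} → x ∈ p → y ∈ p → pair x y ⊆ p
pair⊆ {x = x} x∈p y∈p z∈ with ∈-[]≔inside⁻ z∈
... | inj₁ refl = y∈p
... | inj₂ z∈⁅x⁆ rewrite x∈⁅y⁆⇒x≡y x z∈⁅x⁆ = x∈p

∣pair∣≡2 : {n : ℕ} {x y : Fin n} → x ≢ y → ∣ pair x y ∣ ≡ 2
∣pair∣≡2 {x = x} {y} x≢y = trans (∣p[x]≔inside∣ ⁅ x ⁆ (x≢y ∘ sym ∘ x∈⁅y⁆⇒x≡y x)) (cong suc (∣⁅x⁆∣≡1 x))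

length-filterᵇ-map : {A B : Set} (p : B → Bool) (f : A → B) (xs : List A) →
  length (filterᵇ p (List.map f xs)) ≡ length (filterᵇ (p ∘ f) xs)
length-filterᵇ-map p f [] = refl
length-filterᵇ-map p f (x ∷ xs) with p (f x)
... | true = cong suc (length-filterᵇ-map p f xs)
... | false = length-filterᵇ-map p f xs

countSubsets-∷ : {n : ℕ} (p : Subset (suc n) → Bool) →
  countSubsets p ≡ countSubsets (p ∘ (outside ∷_)) + countSubsets (p ∘ (inside ∷_))
countSubsets-∷ {n} p = begin
  length (filterᵇ p (out ++ ins))                       ≡⟨ cong length (filter-++ (T? ∘ p) out ins) ⟩
  length (filterᵇ p out ++ filterᵇ p ins)               ≡⟨ length-++ (filterᵇ p out) ⟩
  length (filterᵇ p out) + length (filterᵇ p ins)       ≡⟨ cong₂ _+_ (length-filterᵇ-map p _ (allSubsets n))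
                                                                     (length-filterᵇ-map p _ (allSubsets n)) ⟩
  countSubsets (p ∘ (outside ∷_)) + countSubsets (p ∘ (inside ∷_)) ∎
  where
  open ≡-Reasoning
  out ins : List (Subset (suc n))
  out = List.map (outside ∷_) (allSubsets n)
  ins = List.map (inside ∷_) (allSubsets n)

countSubsets-[] : (p : Subset 0 → Bool) → countSubsets p ≡ indicator (p [])
countSubsets-[] p with p []
... | true = refl
... | false = refl

countSubsets-mono : {n : ℕ} {p q : Subset n → Bool} → (∀ C → T (p C) → T (q C)) → countSubsets p ≤ countSubsets q
countSubsets-mono {zero} {p} {q} p⊆q rewrite countSubsets-[] p | countSubsets-[] q
  with p [] | q [] | p⊆q []
... | false | _ | _ = z≤n
... | true | true | _ = ≤-refl
... | true | false | f = ⊥-elim (f tt)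
countSubsets-mono {suc n} {p} {q} p⊆q = begin
  countSubsets p                                                   ≡⟨ countSubsets-∷ p ⟩
  countSubsets (p ∘ (outside ∷_)) + countSubsets (p ∘ (inside ∷_)) ≤⟨ +-mono-≤ (countSubsets-mono (p⊆q ∘ (outside ∷_)))
                                                                              (countSubsets-mono (p⊆q ∘ (inside ∷_))) ⟩
  countSubsets (q ∘ (outside ∷_)) + countSubsets (q ∘ (inside ∷_)) ≡⟨ countSubsets-∷ q ⟨
  countSubsets q                                                   ∎
  where open ≤-Reasoning

countSubsets-cong : {n : ℕ} {p q : Subset n → Bool} →
  (∀ C → T (p C) → T (q C)) → (∀ C → T (q C) → T (p C)) → countSubsets p ≡ countSubsets q
countSubsets-cong p⊆q q⊆p = ≤-antisym (countSubsets-mono p⊆q) (countSubsets-mono q⊆p)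

countSubsets-∨ : {n : ℕ} (p q : Subset n → Bool) → countSubsets (λ C → p C ∨ q C) ≤ countSubsets p + countSubsets q
countSubsets-∨ {zero} p q rewrite countSubsets-[] (λ C → p C ∨ q C) | countSubsets-[] p | countSubsets-[] q
  with p [] | q []
... | true | true = s≤s z≤n
... | true | false = ≤-refl
... | false | _ = ≤-refl
countSubsets-∨ {suc n} p q = begin
  countSubsets (λ C → p C ∨ q C)                          ≡⟨ countSubsets-∷ (λ C → p C ∨ q C) ⟩
  countSubsets (λ C → p₀ C ∨ q₀ C) + countSubsets (λ C → p₁ C ∨ q₁ C)
                                                          ≤⟨ +-mono-≤ (countSubsets-∨ p₀ q₀) (countSubsets-∨ p₁ q₁) ⟩
  (countSubsets p₀ + countSubsets q₀) + (countSubsets p₁ + countSubsets q₁)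
                                                          ≡⟨ +-interchange (countSubsets p₀) _ _ _ ⟩
  (countSubsets p₀ + countSubsets p₁) + (countSubsets q₀ + countSubsets q₁)
                                                          ≡⟨ cong₂ _+_ (countSubsets-∷ p) (countSubsets-∷ q) ⟨
  countSubsets p + countSubsets q                         ∎
  where
  open ≤-Reasoning
  p₀ p₁ q₀ q₁ : Subset n → Bool
  p₀ = p ∘ (outside ∷_)
  p₁ = p ∘ (inside ∷_)
  q₀ = q ∘ (outside ∷_)
  q₁ = q ∘ (inside ∷_)

countSubsets-none : {n : ℕ} (p : Subset n → Bool) → (∀ C → ¬ T (p C)) → countSubsets p ≡ 0
countSubsets-none {n} p none =
  n≤0⇒n≡0 (≤-trans (countSubsets-mono {q = λ _ → false} none) (≤-reflexive (countSubsets-false n)))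
  where
  countSubsets-false : (n : ℕ) → countSubsets {n} (λ _ → false) ≡ 0
  countSubsets-false zero = refl
  countSubsets-false (suc n) =
    trans (countSubsets-∷ {n} (λ _ → false)) (cong₂ _+_ (countSubsets-false n) (countSubsets-false n))

countSubsets-≥1 : {n : ℕ} (p : Subset n → Bool) (S : Subset n) → T (p S) → 1 ≤ countSubsets p
countSubsets-≥1 p [] pS rewrite countSubsets-[] p with p []
... | true = ≤-refl
countSubsets-≥1 p (false ∷ S) pS =
  ≤-trans (countSubsets-≥1 (p ∘ (outside ∷_)) S pS) (≤-trans (m≤m+n _ _) (≤-reflexive (sym (countSubsets-∷ p))))
countSubsets-≥1 p (true ∷ S) pS =
  ≤-trans (countSubsets-≥1 (p ∘ (inside ∷_)) S pS) (≤-trans (m≤n+m _ _) (≤-reflexive (sym (countSubsets-∷ p))))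

countSubsets-≡ : {n : ℕ} (B : Subset n) → countSubsets (λ A → does (A ≟ₛ B)) ≤ 1
countSubsets-≡ [] = ≤-refl
countSubsets-≡ (false ∷ B) rewrite countSubsets-∷ (λ A → does (A ≟ₛ (false ∷ B)))
  | countSubsets-none (λ A → does ((inside ∷ A) ≟ₛ (false ∷ B))) (λ A ())
  | +-identityʳ (countSubsets (λ A → does ((outside ∷ A) ≟ₛ (false ∷ B)))) = countSubsets-≡ B
countSubsets-≡ (true ∷ B) rewrite countSubsets-∷ (λ A → does (A ≟ₛ (true ∷ B)))
  | countSubsets-none (λ A → does ((outside ∷ A) ≟ₛ (true ∷ B))) (λ A ()) = countSubsets-≡ B

countSubsets-split : {n : ℕ} (p : Subset n → Bool) (u : Fin n) →
  countSubsets p ≡ countSubsets (λ C → not (lookup C u) ∧ p C)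
                 + countSubsets (λ C → not (lookup C u) ∧ p (C [ u ]≔ inside))
countSubsets-split {suc n} p zero =
  trans (countSubsets-∷ p)
        (sym (cong₂ _+_ (countSubsets-outside p) (countSubsets-outside (λ C → p (C [ zero ]≔ inside)))))
  where
  countSubsets-outside : (q : Subset (suc n) → Bool) →
    countSubsets (λ C → not (lookup C zero) ∧ q C) ≡ countSubsets (q ∘ (outside ∷_))
  countSubsets-outside q = trans (countSubsets-∷ (λ C → not (lookup C zero) ∧ q C))
    (trans (cong (countSubsets (q ∘ (outside ∷_)) +_) (countSubsets-none (λ C → false ∧ q (inside ∷ C)) (λ C ())))
           (+-identityʳ _))
countSubsets-split {suc n} p (suc u) = begin
  countSubsets p                       ≡⟨ countSubsets-∷ p ⟩
  countSubsets p₀ + countSubsets p₁    ≡⟨ cong₂ _+_ (countSubsets-split p₀ u) (countSubsets-split p₁ u) ⟩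
  (#∌u p₀ + #∋u p₀) + (#∌u p₁ + #∋u p₁) ≡⟨ +-interchange (#∌u p₀) (#∋u p₀) (#∌u p₁) (#∋u p₁) ⟩
  (#∌u p₀ + #∌u p₁) + (#∋u p₀ + #∋u p₁) ≡⟨ cong₂ _+_ (countSubsets-∷ ∌u) (countSubsets-∷ ∋u) ⟨
  countSubsets ∌u + countSubsets ∋u    ∎
  where
  open ≡-Reasoning
  p₀ p₁ : Subset n → Bool
  p₀ = p ∘ (outside ∷_)
  p₁ = p ∘ (inside ∷_)
  ∌u ∋u : Subset (suc n) → Bool
  ∌u C = not (lookup C (suc u)) ∧ p C
  ∋u C = not (lookup C (suc u)) ∧ p (C [ suc u ]≔ inside)
  #∌u #∋u : (Subset n → Bool) → ℕ
  #∌u q = countSubsets (λ C → not (lookup C u) ∧ q C)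
  #∋u q = countSubsets (λ C → not (lookup C u) ∧ q (C [ u ]≔ inside))

countSubsets-anyFin : {n m : ℕ} (q : Fin m → Subset n → Bool) →
  countSubsets (λ A → anyFin (λ y → q y A)) ≤ sum (λ y → countSubsets (q y))
countSubsets-anyFin {n} {zero} q = ≤-reflexive (countSubsets-none {n} (λ _ → false) (λ _ ()))
countSubsets-anyFin {m = suc m} q =
  ≤-trans (countSubsets-∨ (q zero) (λ A → anyFin (λ y → q (suc y) A))) (+-monoʳ-≤ _ (countSubsets-anyFin (q ∘ suc)))

countSubsets-≡-if : {n : ℕ} (b : Bool) (B : Subset n) → countSubsets (λ A → b ∧ does (A ≟ₛ B)) ≤ indicator b
countSubsets-≡-if true B = countSubsets-≡ B
countSubsets-≡-if {n} false B = ≤-reflexive (countSubsets-none {n} (λ _ → false) (λ _ ()))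

anySubset : {n : ℕ} → (Subset n → Bool) → Bool
anySubset {zero} p = p []
anySubset {suc n} p = anySubset (p ∘ (outside ∷_)) ∨ anySubset (p ∘ (inside ∷_))

anySubset⁺ : {n : ℕ} (p : Subset n → Bool) (A : Subset n) → T (p A) → T (anySubset p)
anySubset⁺ p [] pA = pA
anySubset⁺ p (false ∷ A) pA = T-∨⁺ˡ (anySubset⁺ (p ∘ (outside ∷_)) A pA)
anySubset⁺ p (true ∷ A) pA = T-∨⁺ʳ {anySubset (p ∘ (outside ∷_))} (anySubset⁺ (p ∘ (inside ∷_)) A pA)

firstSubset : {n : ℕ} → (Subset n → Bool) → Subset n
firstSubset {zero} p = []
firstSubset {suc n} p = if anySubset (p ∘ (outside ∷_))
  then outside ∷ firstSubset (p ∘ (outside ∷_))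
  else inside ∷ firstSubset (p ∘ (inside ∷_))

firstSubset-sound : {n : ℕ} (p : Subset n → Bool) → T (anySubset p) → T (p (firstSubset p))
firstSubset-sound {zero} p h = h
firstSubset-sound {suc n} p h with anySubset (p ∘ (outside ∷_)) in eq
... | true = firstSubset-sound (p ∘ (outside ∷_)) (Equivalence.from T-≡ eq)
... | false = firstSubset-sound (p ∘ (inside ∷_)) h

∈-allSubsets : {n : ℕ} (S : Subset n) → S ∈ₗ allSubsets n
∈-allSubsets [] = here refl
∈-allSubsets {suc n} (false ∷ S) = ∈-++⁺ˡ (∈-map⁺ (outside ∷_) (∈-allSubsets S))
∈-allSubsets {suc n} (true ∷ S) = ∈-++⁺ʳ (List.map (outside ∷_) (allSubsets n)) (∈-map⁺ (inside ∷_) (∈-allSubsets S))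

-- Cliques

Graph : ℕ → Set
Graph n = Fin n → Fin n → Bool

IsClique : {n : ℕ} → Graph n → Subset n → Set
IsClique G C = ∀ {x y} → x ∈ C → y ∈ C → x ≢ y → T (G x y)

-- Phrased exactly as the adjacency test in turanEdge, so that hyperedges of 𝒯_r(n, ℓ) are by
-- definition the r-sets that are cliques of the Turán graph.
isClique : {n : ℕ} → Graph n → Subset n → Bool
isClique {n} G C =
  all (λ x → all (λ y → ((lookup C x ∧ lookup C y) ∧ not (does (x ≟ y))) ⇒ᵇ G x y) (allFin n)) (allFin n)

isClique⁻ : {n : ℕ} {G : Graph n} {C : Subset n} → T (isClique G C) → IsClique G C
isClique⁻ h {x} {y} x∈C y∈C x≢y =
  T-⇒ᵇ⁻ (T-allFin⁻ _ (T-allFin⁻ _ h x) y) (T-∧⁺ (T-∧⁺ (∈⇒T x∈C) (∈⇒T y∈C)) (≢⇒≟-false x y x≢y))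

isClique⁺ : {n : ℕ} {G : Graph n} {C : Subset n} → IsClique G C → T (isClique G C)
isClique⁺ {n} {C = C} clique = T-all⁺ _ (allFin n) λ x → T-all⁺ _ (allFin n) λ y → T-⇒ᵇ⁺ λ h →
  let x∈C,y∈C = T-∧⁻ˡ {lookup C x ∧ lookup C y} h
  in clique (T⇒∈ (T-∧⁻ˡ x∈C,y∈C)) (T⇒∈ (T-∧⁻ʳ {lookup C x} x∈C,y∈C))
            (≟-false⇒≢ x y (T-∧⁻ʳ {lookup C x ∧ lookup C y} h))

record CliqueIn {n : ℕ} (G : Graph n) (U : Fin n → Bool) (s : ℕ) (C : Subset n) : Set where
  field
    ⊆U : ∀ {x} → x ∈ C → T (U x)
    size : ∣ C ∣ ≡ s
    clique : IsClique G C

-- Opaque, so that G, U, s and C can be inferred from T (isCliqueIn G U s C).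
opaque
  isCliqueIn : {n : ℕ} → Graph n → (Fin n → Bool) → ℕ → Subset n → Bool
  isCliqueIn {n} G U s C = (all (λ x → lookup C x ⇒ᵇ U x) (allFin n) ∧ (∣ C ∣ ≡ᵇ s)) ∧ isClique G C

  isCliqueIn⁻ : {n : ℕ} {G : Graph n} {U : Fin n → Bool} {s : ℕ} {C : Subset n} →
    T (isCliqueIn G U s C) → CliqueIn G U s C
  isCliqueIn⁻ {U = U} {s} {C} h = record
    { ⊆U = λ {x} x∈C → T-⇒ᵇ⁻ (T-allFin⁻ _ (T-∧⁻ˡ (T-∧⁻ˡ h)) x) (∈⇒T x∈C)
    ; size = ≡ᵇ⇒≡ ∣ C ∣ s (T-∧⁻ʳ {all (λ x → lookup C x ⇒ᵇ U x) (allFin _)} (T-∧⁻ˡ h))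
    ; clique = isClique⁻ (T-∧⁻ʳ {_ ∧ (∣ C ∣ ≡ᵇ s)} h)
    }

  isCliqueIn⁺ : {n : ℕ} {G : Graph n} {U : Fin n → Bool} {s : ℕ} {C : Subset n} →
    CliqueIn G U s C → T (isCliqueIn G U s C)
  isCliqueIn⁺ {n} {C = C} K =
    T-∧⁺ (T-∧⁺ (T-all⁺ _ (allFin n) (λ x → T-⇒ᵇ⁺ (⊆U ∘ T⇒∈))) (≡⇒≡ᵇ ∣ C ∣ _ size)) (isClique⁺ clique)
    where open CliqueIn K

cliqueCount : {n : ℕ} → Graph n → (Fin n → Bool) → ℕ → ℕ
cliqueCount G U s = countSubsets (isCliqueIn G U s)

neighbours : {n : ℕ} → Graph n → Fin n → Fin n → Bool
neighbours G u x = (G u x ∧ G x u) ∧ not (does (x ≟ u))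

module _ {n : ℕ} (G : Graph n) where

  cliqueCount-mono : {U V : Fin n → Bool} (s : ℕ) → (∀ {x} → T (U x) → T (V x)) →
    cliqueCount G U s ≤ cliqueCount G V s
  cliqueCount-mono {U} {V} s U⊆V = countSubsets-mono {p = isCliqueIn G U s} {isCliqueIn G V s} λ C h →
    let open CliqueIn (isCliqueIn⁻ h) in isCliqueIn⁺ record { ⊆U = U⊆V ∘ ⊆U ; size = size ; clique = clique }

  cliqueCount-0 : (U : Fin n → Bool) → cliqueCount G U 0 ≡ 1
  cliqueCount-0 U = ≤-antisym
    (≤-trans (countSubsets-mono {p = isCliqueIn G U 0} only-⊥) (countSubsets-≡ {n} ⊥))
    (countSubsets-≥1 (isCliqueIn G U 0) ⊥ (isCliqueIn⁺ ⊥-clique))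
    where
    only-⊥ : ∀ C → T (isCliqueIn G U 0 C) → T (does (C ≟ₛ ⊥))
    only-⊥ C h = Equivalence.from T-≡ (dec-true (C ≟ₛ ⊥) (Empty-unique (∣p∣≡0⇒Empty (CliqueIn.size (isCliqueIn⁻ h)))))
    ⊥-clique : CliqueIn G U 0 ⊥
    ⊥-clique = record { ⊆U = ⊥-elim ∘ ∉⊥ ; size = ∣⊥∣≡0 n ; clique = λ x∈⊥ → ⊥-elim (∉⊥ x∈⊥) }

  cliqueCount-empty : (U : Fin n → Bool) (s : ℕ) → (∀ x → ¬ T (U x)) → cliqueCount G U (suc s) ≡ 0
  cliqueCount-empty U s empty = countSubsets-none (isCliqueIn G U (suc s)) λ C h →
    let open CliqueIn (isCliqueIn⁻ h)
        x , x∈C = ∣p∣≢0⇒Nonempty (λ ∣C∣≡0 → 0≢1+n (trans (sym ∣C∣≡0) size))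
    in empty x (⊆U x∈C)

  ∖-cliqueIn : {U : Fin n → Bool} {u : Fin n} {s : ℕ} {C : Subset n} →
    u ∉ C → CliqueIn G U s C → CliqueIn G (U ∖ u) s C
  ∖-cliqueIn {u = u} u∉C K = record
    { ⊆U = λ {x} x∈C → T-∧⁺ (⊆U x∈C) (≢⇒≟-false x u λ { refl → u∉C x∈C })
    ; size = size
    ; clique = clique
    }
    where open CliqueIn K

  ∖-cliqueIn⁻ : {U : Fin n → Bool} {u : Fin n} {s : ℕ} {C : Subset n} →
    CliqueIn G (U ∖ u) s C → u ∉ C × CliqueIn G U s C
  ∖-cliqueIn⁻ {U} {u} K =
    (λ u∈C → ≟-false⇒≢ u u (T-∧⁻ʳ {U u} (⊆U u∈C)) refl) , record { ⊆U = T-∧⁻ˡ ∘ ⊆U ; size = size ; clique = clique }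
    where open CliqueIn K

  ∉-cliqueIn-neighbours : {U : Fin n → Bool} {u : Fin n} {s : ℕ} {C : Subset n} →
    CliqueIn G (U ∩ neighbours G u) s C → u ∉ C
  ∉-cliqueIn-neighbours {U} {u} K u∈C =
    ≟-false⇒≢ u u (T-∧⁻ʳ {G u u ∧ G u u} (T-∧⁻ʳ {U u} (CliqueIn.⊆U K u∈C))) refl

  insert-cliqueIn : {U : Fin n → Bool} {u : Fin n} {s : ℕ} {C : Subset n} → T (U u) →
    CliqueIn G (U ∩ neighbours G u) s C → CliqueIn G U (suc s) (C [ u ]≔ inside)
  insert-cliqueIn {U} {u} {C = C} Uu K = record
    { ⊆U = λ x∈C′ → [ (λ { refl → Uu }) , T-∧⁻ˡ ∘ ⊆U ]′ (∈-[]≔inside⁻ x∈C′)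
    ; size = trans (∣p[x]≔inside∣ C (∉-cliqueIn-neighbours {U} K)) (cong suc size)
    ; clique = λ x∈C′ y∈C′ x≢y → adjacent (∈-[]≔inside⁻ x∈C′) (∈-[]≔inside⁻ y∈C′) x≢y
    }
    where
    open CliqueIn K
    adjacent-u : ∀ {x} → x ∈ C → T (G u x) × T (G x u)
    adjacent-u {x} x∈C = let h = T-∧⁻ˡ (T-∧⁻ʳ {U x} (⊆U x∈C)) in T-∧⁻ˡ h , T-∧⁻ʳ {G u x} h
    adjacent : ∀ {x y} → x ≡ u ⊎ x ∈ C → y ≡ u ⊎ y ∈ C → x ≢ y → T (G x y)
    adjacent (inj₁ refl) (inj₁ refl) x≢y = ⊥-elim (x≢y refl)
    adjacent (inj₁ refl) (inj₂ y∈C) _ = proj₁ (adjacent-u y∈C)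
    adjacent (inj₂ x∈C) (inj₁ refl) _ = proj₂ (adjacent-u x∈C)
    adjacent (inj₂ x∈C) (inj₂ y∈C) x≢y = clique x∈C y∈C x≢y

  insert-cliqueIn⁻ : {U : Fin n → Bool} {u : Fin n} {s : ℕ} {C : Subset n} → u ∉ C →
    CliqueIn G U (suc s) (C [ u ]≔ inside) → CliqueIn G (U ∩ neighbours G u) s C
  insert-cliqueIn⁻ {u = u} {C = C} u∉C K = record
    { ⊆U = λ {x} x∈C → let x≢u = λ { refl → u∉C x∈C } in
        T-∧⁺ (⊆U (C⊆C′ x∈C))
             (T-∧⁺ (T-∧⁺ (clique u∈C′ (C⊆C′ x∈C) (x≢u ∘ sym)) (clique (C⊆C′ x∈C) u∈C′ x≢u)) (≢⇒≟-false x u x≢u))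
    ; size = suc-injective (trans (sym (∣p[x]≔inside∣ C u∉C)) size)
    ; clique = λ x∈C y∈C → clique (C⊆C′ x∈C) (C⊆C′ y∈C)
    }
    where
    open CliqueIn K
    u∈C′ : u ∈ C [ u ]≔ inside
    u∈C′ = []≔-updates C u
    C⊆C′ : ∀ {x} → x ∈ C → x ∈ C [ u ]≔ inside
    C⊆C′ x∈C = ∈-[]≔⁺ (λ { refl → u∉C x∈C }) x∈C

  -- An (s + 1)-clique inside U either avoids u, or is u together with an s-clique of
  -- common neighbours of u.
  cliqueCount-remove : {U : Fin n → Bool} {u : Fin n} (s : ℕ) → T (U u) →
    cliqueCount G U (suc s) ≡ cliqueCount G (U ∖ u) (suc s) + cliqueCount G (U ∩ neighbours G u) s
  cliqueCount-remove {U} {u} s Uu = trans (countSubsets-split (isCliqueIn G U (suc s)) u) (cong₂ _+_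
    (countSubsets-cong
      (λ C h → isCliqueIn⁺ (∖-cliqueIn (T-not⁻ (T-∧⁻ˡ h) ∘ ∈⇒T) (isCliqueIn⁻ (T-∧⁻ʳ {not (lookup C u)} h))))
      (λ C h → let u∉C , K = ∖-cliqueIn⁻ (isCliqueIn⁻ h) in T-∧⁺ (T-not⁺ (u∉C ∘ T⇒∈)) (isCliqueIn⁺ K)))
    (countSubsets-cong
      (λ C h → let u∉C = T-not⁻ (T-∧⁻ˡ h) ∘ ∈⇒T in
        isCliqueIn⁺ (insert-cliqueIn⁻ u∉C (isCliqueIn⁻ (T-∧⁻ʳ {not (lookup C u)} h))))
      (λ C h → let K = isCliqueIn⁻ h in
        T-∧⁺ (T-not⁺ (∉-cliqueIn-neighbours {U} K ∘ T⇒∈)) (isCliqueIn⁺ (insert-cliqueIn Uu K)))))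

  cliqueCount-1 : (U : Fin n → Bool) → cliqueCount G U 1 ≡ count U
  cliqueCount-1 = count-rec (λ U → cliqueCount G U 1 ≡ count U) step
    where
    step : ∀ U → (∀ {V} → count V < count U → cliqueCount G V 1 ≡ count V) → cliqueCount G U 1 ≡ count U
    step U rec with any? (T? ∘ U)
    ... | no ∄u = trans (cliqueCount-empty U 0 (λ x Ux → ∄u (x , Ux))) (sym (count-none U (λ x Ux → ∄u (x , Ux))))
    ... | yes (u , Uu) = begin
      cliqueCount G U 1                                              ≡⟨ cliqueCount-remove 0 Uu ⟩
      cliqueCount G (U ∖ u) 1 + cliqueCount G (U ∩ neighbours G u) 0 ≡⟨ cong₂ _+_ (rec (count-∖-< U Uu))
                                                                                  (cliqueCount-0 _) ⟩
      count (U ∖ u) + 1                                              ≡⟨ +-comm _ 1 ⟩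
      suc (count (U ∖ u))                                            ≡⟨ count-∖ U Uu ⟨
      count U                                                        ∎
      where open ≡-Reasoning

-- Elementary symmetric polynomials

esym : ℕ → {ℓ : ℕ} → (Fin ℓ → ℕ) → ℕ
esym zero P = 1
esym (suc s) {zero} P = 0
esym (suc s) {suc ℓ} P = esym (suc s) (P ∘ suc) + P zero * esym s (P ∘ suc)

esymPrev : ℕ → {ℓ : ℕ} → (Fin ℓ → ℕ) → ℕ
esymPrev zero P = 0
esymPrev (suc s) P = esym s P

zeroAt : {ℓ : ℕ} → Fin ℓ → (Fin ℓ → ℕ) → Fin ℓ → ℕ
zeroAt i P = updateAt P i (const 0)

esym-cong : (s : ℕ) {ℓ : ℕ} {P Q : Fin ℓ → ℕ} → (∀ k → P k ≡ Q k) → esym s P ≡ esym s Q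
esym-cong zero P≗Q = refl
esym-cong (suc s) {zero} P≗Q = refl
esym-cong (suc s) {suc ℓ} P≗Q =
  cong₂ _+_ (esym-cong (suc s) (P≗Q ∘ suc)) (cong₂ _*_ (P≗Q zero) (esym-cong s (P≗Q ∘ suc)))

esymPrev-cong : (s : ℕ) {ℓ : ℕ} {P Q : Fin ℓ → ℕ} → (∀ k → P k ≡ Q k) → esymPrev s P ≡ esymPrev s Q
esymPrev-cong zero P≗Q = refl
esymPrev-cong (suc s) P≗Q = esym-cong s P≗Q

esym-mono : (s : ℕ) {ℓ : ℕ} {P Q : Fin ℓ → ℕ} → (∀ k → P k ≤ Q k) → esym s P ≤ esym s Q
esym-mono zero P≤Q = ≤-refl
esym-mono (suc s) {zero} P≤Q = ≤-refl
esym-mono (suc s) {suc ℓ} P≤Q =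
  +-mono-≤ (esym-mono (suc s) (P≤Q ∘ suc)) (*-mono-≤ (P≤Q zero) (esym-mono s (P≤Q ∘ suc)))

esym-∷ : (s : ℕ) {ℓ : ℕ} (P : Fin (suc ℓ) → ℕ) → esym s P ≡ esym s (P ∘ suc) + P zero * esymPrev s (P ∘ suc)
esym-∷ zero P = sym (cong suc (*-zeroʳ (P zero)))
esym-∷ (suc s) P = refl

esym-1 : {ℓ : ℕ} (P : Fin ℓ → ℕ) → esym 1 P ≡ sum P
esym-1 {zero} P = refl
esym-1 {suc ℓ} P = trans (cong₂ _+_ (esym-1 (P ∘ suc)) (*-identityʳ (P zero))) (+-comm _ (P zero))

esym-zeros : (s : ℕ) {ℓ : ℕ} (P : Fin ℓ → ℕ) → (∀ k → P k ≡ 0) → esym (suc s) P ≡ 0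
esym-zeros s {zero} P P≡0 = refl
esym-zeros s {suc ℓ} P P≡0 =
  cong₂ _+_ (esym-zeros s (P ∘ suc) (P≡0 ∘ suc)) (cong (_* esym s (P ∘ suc)) (P≡0 zero))

esym-vanishes : (s : ℕ) {ℓ : ℕ} (P : Fin ℓ → ℕ) → ℓ < s → esym s P ≡ 0
esym-vanishes (suc s) {zero} P ℓ<s = refl
esym-vanishes (suc s) {suc ℓ} P (s≤s ℓ<s) =
  cong₂ _+_ (esym-vanishes (suc s) (P ∘ suc) (m≤n⇒m≤1+n ℓ<s))
            (trans (cong (P zero *_) (esym-vanishes s (P ∘ suc) ℓ<s)) (*-zeroʳ (P zero)))

esym-zeroAt : (s : ℕ) {ℓ : ℕ} (i : Fin ℓ) (P : Fin ℓ → ℕ) →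
  esym s P ≡ esym s (zeroAt i P) + P i * esymPrev s (zeroAt i P)
esym-zeroAt zero i P = sym (cong suc (*-zeroʳ (P i)))
esym-zeroAt (suc s) {suc ℓ} zero P = sym (cong₂ (λ a b → a + P zero * b)
  (+-identityʳ (esym (suc s) (P ∘ suc))) (trans (esym-∷ s (zeroAt zero P)) (+-identityʳ _)))
esym-zeroAt (suc s) {suc ℓ} (suc i) P = begin
  esym (suc s) Q + p * esym s Q
    ≡⟨ cong₂ (λ a b → a + p * b) (esym-zeroAt (suc s) i Q) (esym-zeroAt s i Q) ⟩
  (esym (suc s) Q₀ + q * esym s Q₀) + p * (esym s Q₀ + q * esymPrev s Q₀)
    ≡⟨ swap (esym (suc s) Q₀) (esym s Q₀) (esymPrev s Q₀) p q ⟩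
  (esym (suc s) Q₀ + p * esym s Q₀) + q * (esym s Q₀ + p * esymPrev s Q₀)
    ≡⟨ cong (λ b → esym (suc s) Q₀ + p * esym s Q₀ + q * b) (esym-∷ s (zeroAt (suc i) P)) ⟨
  esym (suc s) (zeroAt (suc i) P) + q * esym s (zeroAt (suc i) P)
    ∎
  where
  open ≡-Reasoning
  Q = P ∘ suc
  Q₀ = zeroAt i Q
  p = P zero
  q = P (suc i)
  swap : ∀ a b c p q → (a + q * b) + p * (b + q * c) ≡ (a + p * b) + q * (b + p * c)
  swap = solve-∀

esym-decrement : (s : ℕ) {ℓ : ℕ} (c : Fin ℓ) (P : Fin ℓ → ℕ) → 0 < P c →
  esym (suc s) P ≡ esym (suc s) (updateAt P c pred) + esym s (zeroAt c P)
esym-decrement s c P 0<Pc = begin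
  esym (suc s) P                                          ≡⟨ esym-zeroAt (suc s) c P ⟩
  esym (suc s) P₀ + P c * esym s P₀                       ≡⟨ cong (λ x → esym (suc s) P₀ + x * esym s P₀) Pc≡1+x ⟩
  esym (suc s) P₀ + suc (pred (P c)) * esym s P₀          ≡⟨ split (esym (suc s) P₀) (esym s P₀) (pred (P c)) ⟩
  (esym (suc s) P₀ + pred (P c) * esym s P₀) + esym s P₀  ≡⟨ cong (_+ esym s P₀) esym-P′ ⟨
  esym (suc s) P′ + esym s P₀                             ∎
  where
  open ≡-Reasoning
  P₀ = zeroAt c P
  P′ = updateAt P c pred
  Pc≡1+x : P c ≡ suc (pred (P c))
  Pc≡1+x = sym (suc-pred (P c) {{>-nonZero 0<Pc}})
  split : ∀ a b x → a + suc x * b ≡ (a + x * b) + b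
  split = solve-∀
  P′₀≗P₀ : ∀ k → zeroAt c P′ k ≡ P₀ k
  P′₀≗P₀ = updateAt-updateAt c P
  esym-P′ : esym (suc s) P′ ≡ esym (suc s) P₀ + pred (P c) * esym s P₀
  esym-P′ = trans (esym-zeroAt (suc s) c P′)
    (cong₂ _+_ (esym-cong (suc s) P′₀≗P₀) (cong₂ _*_ (updateAt-updates c P) (esym-cong s P′₀≗P₀)))

zeroAt₂-cong : {ℓ : ℕ} {P Q : Fin ℓ → ℕ} (i j : Fin ℓ) → (∀ k → k ≢ i → k ≢ j → P k ≡ Q k) →
  ∀ k → zeroAt j (zeroAt i P) k ≡ zeroAt j (zeroAt i Q) k
zeroAt₂-cong {P = P} {Q} i j P≗Q k with k ≟ j
... | yes refl = trans (updateAt-updates k (zeroAt i P)) (sym (updateAt-updates k (zeroAt i Q)))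
... | no k≢j with k ≟ i
...   | yes refl = trans (updateAt-minimal k j (zeroAt k P) k≢j)
                   (trans (updateAt-updates k P)
                   (sym (trans (updateAt-minimal k j (zeroAt k Q) k≢j) (updateAt-updates k Q))))
...   | no k≢i = trans (updateAt-minimal k j (zeroAt i P) k≢j)
                 (trans (updateAt-minimal k i P k≢i)
                 (trans (P≗Q k k≢i k≢j)
                 (sym (trans (updateAt-minimal k j (zeroAt i Q) k≢j) (updateAt-minimal k i Q k≢i)))))

esym-zeroAt₂ : (s : ℕ) {ℓ : ℕ} {i j : Fin ℓ} (P : Fin ℓ → ℕ) → i ≢ j →
  esym (suc s) P ≡ (esym (suc s) (zeroAt j (zeroAt i P)) + P j * esym s (zeroAt j (zeroAt i P)))
                   + P i * (esym s (zeroAt j (zeroAt i P)) + P j * esymPrev s (zeroAt j (zeroAt i P)))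
esym-zeroAt₂ s {i = i} {j} P i≢j = trans (esym-zeroAt (suc s) i P) (cong₂ (λ a b → a + P i * b)
  (trans (esym-zeroAt (suc s) j Q) (cong (λ q → esym (suc s) R + q * esym s R) Qj≡Pj))
  (trans (esym-zeroAt s j Q) (cong (λ q → esym s R + q * esymPrev s R) Qj≡Pj)))
  where
  Q = zeroAt i P
  R = zeroAt j Q
  Qj≡Pj : Q j ≡ P j
  Qj≡Pj = updateAt-minimal j i P (i≢j ∘ sym)

moveUnit : {ℓ : ℕ} → Fin ℓ → Fin ℓ → (Fin ℓ → ℕ) → Fin ℓ → ℕ
moveUnit i j P = updateAt (updateAt P i pred) j suc

moveUnit-source : {ℓ : ℕ} {i j : Fin ℓ} (P : Fin ℓ → ℕ) → i ≢ j → moveUnit i j P i ≡ pred (P i)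
moveUnit-source {i = i} {j} P i≢j = trans (updateAt-minimal i j (updateAt P i pred) i≢j) (updateAt-updates i P)

moveUnit-target : {ℓ : ℕ} {i j : Fin ℓ} (P : Fin ℓ → ℕ) → i ≢ j → moveUnit i j P j ≡ suc (P j)
moveUnit-target {i = i} {j} P i≢j =
  trans (updateAt-updates j (updateAt P i pred)) (cong suc (updateAt-minimal j i P (i≢j ∘ sym)))

moveUnit-other : {ℓ : ℕ} {i j : Fin ℓ} (P : Fin ℓ → ℕ) (k : Fin ℓ) → k ≢ i → k ≢ j → moveUnit i j P k ≡ P k
moveUnit-other {i = i} {j} P k k≢i k≢j =
  trans (updateAt-minimal k j (updateAt P i pred) k≢j) (updateAt-minimal k i P k≢i)

-- Writing x for the source and y for the target entry, e_s = A + (x + y) B + x y C with A, B, C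
-- independent of x and y, and moving a unit keeps x + y while (x - 1)(y + 1) ≥ x y iff y < x.
transfer-≤ : (a b c : ℕ) {x y : ℕ} → y < x →
  (a + y * b) + x * (b + y * c) ≤ (a + suc y * b) + pred x * (b + suc y * c)
transfer-≤ a b c {suc x} {y} (s≤s y≤x) = begin
  (a + y * b) + suc x * (b + y * c)          ≡⟨ lhs a b c x y ⟩
  (a + y * b + b + x * b + x * y * c) + y * c ≤⟨ +-monoʳ-≤ (a + y * b + b + x * b + x * y * c) (*-monoˡ-≤ c y≤x) ⟩
  (a + y * b + b + x * b + x * y * c) + x * c ≡⟨ rhs a b c x y ⟨
  (a + suc y * b) + x * (b + suc y * c)      ∎
  where
  open ≤-Reasoning
  lhs : ∀ a b c x y → (a + y * b) + suc x * (b + y * c) ≡ (a + y * b + b + x * b + x * y * c) + y * c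
  lhs = solve-∀
  rhs : ∀ a b c x y → (a + suc y * b) + x * (b + suc y * c) ≡ (a + y * b + b + x * b + x * y * c) + x * c
  rhs = solve-∀

esym-moveUnit : (s : ℕ) {ℓ : ℕ} {i j : Fin ℓ} (P : Fin ℓ → ℕ) → i ≢ j → P j < P i →
  esym s P ≤ esym s (moveUnit i j P)
esym-moveUnit zero P _ _ = ≤-refl
esym-moveUnit (suc s) {ℓ} {i} {j} P i≢j Pj<Pi = begin
  esym (suc s) P                ≡⟨ esym-zeroAt₂ s P i≢j ⟩
  E R (P j) (P i)               ≤⟨ transfer-≤ (esym (suc s) R) (esym s R) (esymPrev s R) Pj<Pi ⟩
  E R (suc (P j)) (pred (P i))  ≡⟨ cong₂ (E R) (moveUnit-target P i≢j) (moveUnit-source P i≢j) ⟨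
  E R (P′ j) (P′ i)             ≡⟨ cong₂ (λ a b → a + P′ i * b)
                                         (cong₂ (λ a b → a + P′ j * b) (esym-cong (suc s) R≗R′) (esym-cong s R≗R′))
                                         (cong₂ (λ b c → b + P′ j * c) (esym-cong s R≗R′) (esymPrev-cong s R≗R′)) ⟩
  E R′ (P′ j) (P′ i)            ≡⟨ esym-zeroAt₂ s P′ i≢j ⟨
  esym (suc s) P′               ∎
  where
  open ≤-Reasoning
  P′ = moveUnit i j P
  R = zeroAt j (zeroAt i P)
  R′ = zeroAt j (zeroAt i P′)
  E : (Fin ℓ → ℕ) → ℕ → ℕ → ℕ
  E X y x = (esym (suc s) X + y * esym s X) + x * (esym s X + y * esymPrev s X)
  R≗R′ : ∀ k → R k ≡ R′ k
  R≗R′ = zeroAt₂-cong i j (λ k k≢i k≢j → sym (moveUnit-other P k k≢i k≢j))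

Balanced : {ℓ : ℕ} → (Fin ℓ → ℕ) → Set
Balanced B = ∀ i j → B j ≤ suc (B i)

sum-moveUnit : {ℓ : ℕ} {i j : Fin ℓ} (P : Fin ℓ → ℕ) → i ≢ j → 0 < P i → sum (moveUnit i j P) ≡ sum P
sum-moveUnit {i = i} {j} P i≢j 0<Pi with P i | sum-updateAt P i pred
... | suc x | ΣQ+Pi≡ΣP+x = +-cancelʳ-≡ (P j) _ _ (begin
  sum (moveUnit i j P) + P j     ≡⟨ cong (sum (moveUnit i j P) +_) (updateAt-minimal j i P (i≢j ∘ sym)) ⟨
  sum (moveUnit i j P) + Q j     ≡⟨ sum-updateAt Q j suc ⟩
  sum Q + suc (Q j)              ≡⟨ +-suc (sum Q) (Q j) ⟩
  suc (sum Q + Q j)              ≡⟨ cong (λ q → suc (sum Q + q)) (updateAt-minimal j i P (i≢j ∘ sym)) ⟩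
  suc (sum Q + P j)              ≡⟨ cong (_+ P j) ΣQ+1≡ΣP ⟩
  sum P + P j                    ∎)
  where
  open ≡-Reasoning
  Q = updateAt P i pred
  ΣQ+1≡ΣP : suc (sum Q) ≡ sum P
  ΣQ+1≡ΣP = +-cancelʳ-≡ x _ _ (trans (sym (+-suc (sum Q) x)) ΣQ+Pi≡ΣP+x)

excess : {ℓ : ℕ} → (B P : Fin ℓ → ℕ) → ℕ
excess B P = sum (λ k → P k ∸ B k)

excess-moveUnit : {ℓ : ℕ} {B P : Fin ℓ → ℕ} {i j : Fin ℓ} → B i < P i → P j < B j →
  suc (excess B (moveUnit i j P)) ≡ excess B P
excess-moveUnit {B = B} {P} {i} {j} Bi<Pi Pj<Bj with P i ∸ B i in Di≡ | sum-updateAt (λ k → P k ∸ B k) i pred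
... | zero | _ = ⊥-elim (<⇒≢ (m<n⇒0<n∸m Bi<Pi) (sym Di≡))
... | suc d | ΣD′+Di≡ΣD+d =
  +-cancelʳ-≡ d _ _ (trans (sym (+-suc _ d)) (trans (cong (_+ suc d) (sum-cong-≗ D′≗)) ΣD′+Di≡ΣD+d))
  where
  D = λ k → P k ∸ B k
  i≢j : i ≢ j
  i≢j refl = <-asym Bi<Pi Pj<Bj
  D′≗ : ∀ k → moveUnit i j P k ∸ B k ≡ updateAt D i pred k
  D′≗ k with k ≟ i | k ≟ j
  ... | yes refl | _ = trans (cong (_∸ B k) (moveUnit-source P i≢j))
                      (trans (∸-+-assoc (P k) 1 (B k))
                      (trans (sym (pred[m∸n]≡m∸[1+n] (P k) (B k))) (sym (updateAt-updates k D))))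
  ... | no k≢i | yes refl = trans (m≤n⇒m∸n≡0 (≤-trans (≤-reflexive (moveUnit-target P i≢j)) Pj<Bj))
                           (trans (sym (m≤n⇒m∸n≡0 (<⇒≤ Pj<Bj))) (sym (updateAt-minimal k i D k≢i)))
  ... | no k≢i | no k≢j = trans (cong (_∸ B k) (moveUnit-other P k k≢i k≢j)) (sym (updateAt-minimal k i D k≢i))

-- Moving units from entries above a balanced B to entries below it never decreases e_s,
-- and each move lowers the total excess over B.
esym-≤-balanced : (s : ℕ) {ℓ : ℕ} {B P : Fin ℓ → ℕ} → Balanced B → sum P ≡ sum B → esym s P ≤ esym s B
esym-≤-balanced s {B = B} {P} balanced = go (excess B P) ≤-refl
  where
  go : ∀ d {P} → excess B P ≤ d → sum P ≡ sum B → esym s P ≤ esym s B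
  go zero {P} excess≤0 _ =
    esym-mono s (λ k → m∸n≡0⇒m≤n (n≤0⇒n≡0 (≤-trans (≤-sum (λ k → P k ∸ B k) k) excess≤0)))
  go (suc d) {P} excess≤1+d ΣP≡ΣB with any? (λ i → B i <? P i)
  ... | no ∄i = esym-mono s (λ k → ≮⇒≥ (λ Bk<Pk → ∄i (k , Bk<Pk)))
  ... | yes (i , Bi<Pi) with any? (λ j → P j <? B j)
  ...   | no ∄j = ⊥-elim (<-irrefl (sym ΣP≡ΣB) (sum-mono-< i (λ k → ≮⇒≥ (λ Pk<Bk → ∄j (k , Pk<Bk))) Bi<Pi))
  ...   | yes (j , Pj<Bj) = ≤-trans (esym-moveUnit s P i≢j Pj<Pi)
          (go d (s≤s⁻¹ (≤-trans (≤-reflexive (excess-moveUnit {B = B} {P} Bi<Pi Pj<Bj)) excess≤1+d))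
                (trans (sum-moveUnit P i≢j (≤-<-trans z≤n Pj<Pi)) ΣP≡ΣB))
    where
    i≢j : i ≢ j
    i≢j refl = <-asym Bi<Pi Pj<Bj
    Pj<Pi : P j < P i
    Pj<Pi = ≤-trans Pj<Bj (≤-trans (balanced i j) Bi<Pi)

-- Complete multipartite graphs

multipartite : {n : ℕ} → (Fin n → ℕ) → Graph n
multipartite col x y = not (col x ≡ᵇ col y)

partSizes : {n : ℕ} (ℓ : ℕ) → (Fin n → ℕ) → (Fin n → Bool) → Fin ℓ → ℕ
partSizes ℓ col U j = count (λ i → U i ∧ (col i ≡ᵇ toℕ j))

module _ {n ℓ : ℕ} (col : Fin n → ℕ) where

  partSizes-∖ : {U : Fin n → Bool} {u : Fin n} {c : Fin ℓ} → T (U u) → col u ≡ toℕ c →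
    ∀ j → partSizes ℓ col (U ∖ u) j ≡ updateAt (partSizes ℓ col U) c pred j
  partSizes-∖ {U} {u} {c} Uu colu≡c j with j ≟ c
  ... | yes refl = begin
    partSizes ℓ col (U ∖ u) j               ≡⟨ count-cong-≗ (λ i → ∧-swapʳ (U i) _ _) ⟩
    count (V ∖ u)                           ≡⟨ cong pred (count-∖ V (T-∧⁺ Uu (≡⇒≡ᵇ (col u) (toℕ j) colu≡c))) ⟨
    pred (count V)                          ≡⟨ updateAt-updates j (partSizes ℓ col U) ⟨
    updateAt (partSizes ℓ col U) j pred j   ∎
    where
    open ≡-Reasoning
    V : Fin n → Bool
    V i = U i ∧ (col i ≡ᵇ toℕ j)
  ... | no j≢c = trans (count-cong (λ i h → T-∧⁺ (T-∧⁻ˡ (T-∧⁻ˡ h)) (T-∧⁻ʳ {U i ∧ _} h)) still-in)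
                       (sym (updateAt-minimal j c (partSizes ℓ col U) j≢c))
    where
    still-in : ∀ i → T (U i ∧ (col i ≡ᵇ toℕ j)) → T ((U ∖ u) i ∧ (col i ≡ᵇ toℕ j))
    still-in i h = T-∧⁺ (T-∧⁺ (T-∧⁻ˡ h) (≢⇒≟-false i u i≢u)) (T-∧⁻ʳ {U i} h)
      where
      i≢u : i ≢ u
      i≢u refl = j≢c (toℕ-injective (trans (sym (≡ᵇ⇒≡ (col u) (toℕ j) (T-∧⁻ʳ {U u} h))) colu≡c))

  partSizes-neighbours : {U : Fin n → Bool} {u : Fin n} {c : Fin ℓ} → col u ≡ toℕ c →
    ∀ j → partSizes ℓ col (U ∩ neighbours (multipartite col) u) j ≡ zeroAt c (partSizes ℓ col U) j
  partSizes-neighbours {U} {u} {c} colu≡c j with j ≟ c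
  ... | yes refl = trans (count-none _ not-neighbour) (sym (updateAt-updates j (partSizes ℓ col U)))
    where
    not-neighbour : ∀ i → ¬ T ((U i ∧ neighbours (multipartite col) u i) ∧ (col i ≡ᵇ toℕ j))
    not-neighbour i h = T-not⁻ (T-∧⁻ˡ (T-∧⁻ˡ (T-∧⁻ʳ {U i} (T-∧⁻ˡ h))))
      (≡⇒≡ᵇ (col u) (col i) (trans colu≡c (sym (≡ᵇ⇒≡ (col i) (toℕ j) (T-∧⁻ʳ {U i ∧ _} h)))))
  ... | no j≢c = trans (count-cong (λ i h → T-∧⁺ (T-∧⁻ˡ (T-∧⁻ˡ h)) (T-∧⁻ʳ {U i ∧ _} h)) neighbour)
                       (sym (updateAt-minimal j c (partSizes ℓ col U) j≢c))
    where
    neighbour : ∀ i → T (U i ∧ (col i ≡ᵇ toℕ j)) → T ((U i ∧ neighbours (multipartite col) u i) ∧ (col i ≡ᵇ toℕ j))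
    neighbour i h = T-∧⁺ {U i ∧ neighbours (multipartite col) u i}
      (T-∧⁺ (T-∧⁻ˡ {U i} h) (T-∧⁺ (T-∧⁺ (T-not⁺ colu≢coli) (T-not⁺ (colu≢coli ∘ ≡ᵇ-sym))) (≢⇒≟-false i u i≢u)))
      (T-∧⁻ʳ {U i} h)
      where
      colu≢coli : ¬ T (col u ≡ᵇ col i)
      colu≢coli h′ = j≢c (toℕ-injective
        (trans (sym (≡ᵇ⇒≡ (col i) (toℕ j) (T-∧⁻ʳ {U i} h))) (trans (sym (≡ᵇ⇒≡ (col u) (col i) h′)) colu≡c)))
      ≡ᵇ-sym : T (col i ≡ᵇ col u) → T (col u ≡ᵇ col i)
      ≡ᵇ-sym h′ = ≡⇒≡ᵇ (col u) (col i) (sym (≡ᵇ⇒≡ (col i) (col u) h′))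
      i≢u : i ≢ u
      i≢u refl = colu≢coli (≡⇒≡ᵇ (col u) (col u) refl)

  -- Removing a vertex u of colour c decrements part c; its neighbourhood is U with part c emptied.
  cliqueCount-multipartite : (∀ i → col i < ℓ) →
    ∀ U s → cliqueCount (multipartite col) U s ≡ esym s (partSizes ℓ col U)
  cliqueCount-multipartite col<ℓ = count-rec _ step
    where
    G = multipartite col
    step : ∀ U → (∀ {V} → count V < count U → ∀ s → cliqueCount G V s ≡ esym s (partSizes ℓ col V)) →
      ∀ s → cliqueCount G U s ≡ esym s (partSizes ℓ col U)
    step U rec zero = cliqueCount-0 G U
    step U rec (suc s) with any? (T? ∘ U)
    ... | no ∄u = trans (cliqueCount-empty G U s (λ x Ux → ∄u (x , Ux)))
      (sym (esym-zeros s (partSizes ℓ col U) λ j →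
        count-none (λ i → U i ∧ (col i ≡ᵇ toℕ j)) λ i h → ∄u (i , T-∧⁻ˡ h)))
    ... | yes (u , Uu) = begin
      cliqueCount G U (suc s)
        ≡⟨ cliqueCount-remove G s Uu ⟩
      cliqueCount G (U ∖ u) (suc s) + cliqueCount G (U ∩ neighbours G u) s
        ≡⟨ cong₂ _+_ (rec (count-∖-< U Uu) (suc s)) (rec (≤-<-trans (count-mono N⊆U∖u) (count-∖-< U Uu)) s) ⟩
      esym (suc s) (partSizes ℓ col (U ∖ u)) + esym s (partSizes ℓ col (U ∩ neighbours G u))
        ≡⟨ cong₂ _+_ (esym-cong (suc s) (partSizes-∖ Uu colu≡c)) (esym-cong s (partSizes-neighbours colu≡c)) ⟩
      esym (suc s) (updateAt P c pred) + esym s (zeroAt c P)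
        ≡⟨ esym-decrement s c P (≤-<-trans z≤n (count-∖-< (λ i → U i ∧ (col i ≡ᵇ toℕ c)) Vu)) ⟨
      esym (suc s) P
        ∎
      where
      open ≡-Reasoning
      c : Fin ℓ
      c = fromℕ< (col<ℓ u)
      colu≡c : col u ≡ toℕ c
      colu≡c = sym (toℕ-fromℕ< (col<ℓ u))
      P = partSizes ℓ col U
      Vu : T (U u ∧ (col u ≡ᵇ toℕ c))
      Vu = T-∧⁺ Uu (≡⇒≡ᵇ (col u) (toℕ c) colu≡c)
      N⊆U∖u : ∀ i → T ((U ∩ neighbours G u) i) → T ((U ∖ u) i)
      N⊆U∖u i h = T-∧⁺ (T-∧⁻ˡ h) (T-∧⁻ʳ {G u i ∧ G i u} (T-∧⁻ʳ {U i} h))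

sum-partSizes : {n : ℕ} (ℓ : ℕ) (col : Fin n → ℕ) → (∀ i → col i < ℓ) → (U : Fin n → Bool) →
  sum (partSizes ℓ col U) ≡ count U
sum-partSizes ℓ col col<ℓ U = begin
  sum (partSizes ℓ col U)                   ≡⟨ esym-1 (partSizes ℓ col U) ⟨
  esym 1 (partSizes ℓ col U)                ≡⟨ cliqueCount-multipartite col col<ℓ U 1 ⟨
  cliqueCount (multipartite col) U 1        ≡⟨ cliqueCount-1 (multipartite col) U ⟩
  count U                                   ∎
  where open ≡-Reasoning

-- Balanced residue partitions

indicator-<ᵇ-suc : ∀ j r → indicator (j <ᵇ r) + indicator (r ≡ᵇ j) ≡ indicator (j <ᵇ suc r)
indicator-<ᵇ-suc zero zero = refl
indicator-<ᵇ-suc zero (suc r) = refl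
indicator-<ᵇ-suc (suc j) zero = refl
indicator-<ᵇ-suc (suc j) (suc r) = indicator-<ᵇ-suc j r

module _ (k : ℕ) where

  private
    ℓ = suc k

  suc-%-≡ : ∀ m → suc m % ℓ ≡ suc (m % ℓ) % ℓ
  suc-%-≡ m = trans (cong (λ x → suc x % ℓ) (m≡m%n+[m/n]*n m ℓ)) ([m+kn]%n≡m%n (suc (m % ℓ)) (m / ℓ) ℓ)

  residueClassSize : ℕ → ℕ → ℕ
  residueClassSize m j = count {m} (λ i → toℕ i % ℓ ≡ᵇ j)

  residueClassSize-suc : ∀ m q → (∀ j → j < ℓ → residueClassSize m j ≡ q + indicator (j <ᵇ m % ℓ)) →
    ∀ j → j < ℓ → residueClassSize (suc m) j ≡ q + indicator (j <ᵇ suc (m % ℓ))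
  residueClassSize-suc m q #≡ j j<ℓ = begin
    residueClassSize (suc m) j                                ≡⟨ count-toℕ-suc (λ x → x % ℓ ≡ᵇ j) m ⟩
    residueClassSize m j + indicator (m % ℓ ≡ᵇ j)             ≡⟨ cong (_+ indicator (m % ℓ ≡ᵇ j)) (#≡ j j<ℓ) ⟩
    (q + indicator (j <ᵇ m % ℓ)) + indicator (m % ℓ ≡ᵇ j)     ≡⟨ +-assoc q _ _ ⟩
    q + (indicator (j <ᵇ m % ℓ) + indicator (m % ℓ ≡ᵇ j))     ≡⟨ cong (q +_) (indicator-<ᵇ-suc j (m % ℓ)) ⟩
    q + indicator (j <ᵇ suc (m % ℓ))                          ∎
    where open ≡-Reasoning

  residueClassSize≡ : ∀ m → ∃ λ q → ∀ j → j < ℓ → residueClassSize m j ≡ q + indicator (j <ᵇ m % ℓ)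
  residueClassSize≡ zero = 0 , λ j _ → refl
  residueClassSize≡ (suc m) with q , #≡ ← residueClassSize≡ m | m≤n⇒m<n∨m≡n (m%n<n m ℓ)
  ... | inj₁ 1+r<ℓ = q , λ j j<ℓ → trans (residueClassSize-suc m q #≡ j j<ℓ)
    (cong (λ r → q + indicator (j <ᵇ r)) (sym (trans (suc-%-≡ m) (m<n⇒m%n≡m 1+r<ℓ))))
  ... | inj₂ 1+r≡ℓ = suc q , λ j j<ℓ → begin
    residueClassSize (suc m) j           ≡⟨ residueClassSize-suc m q #≡ j j<ℓ ⟩
    q + indicator (j <ᵇ suc (m % ℓ))     ≡⟨ cong (λ r → q + indicator (j <ᵇ r)) 1+r≡ℓ ⟩
    q + indicator (j <ᵇ ℓ)               ≡⟨ cong (λ b → q + indicator b) (Equivalence.to T-≡ (<⇒<ᵇ j<ℓ)) ⟩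
    q + 1                                ≡⟨ trans (+-comm q 1) (sym (+-identityʳ (suc q))) ⟩
    suc q + indicator (j <ᵇ 0)           ≡⟨ cong (λ r → suc q + indicator (j <ᵇ r)) 1+m%ℓ≡0 ⟨
    suc q + indicator (j <ᵇ suc m % ℓ)   ∎
    where
    open ≡-Reasoning
    1+m%ℓ≡0 : suc m % ℓ ≡ 0
    1+m%ℓ≡0 = trans (suc-%-≡ m) (trans (cong (_% ℓ) 1+r≡ℓ) (n%n≡0 ℓ))

  residueParts : (m : ℕ) → Fin ℓ → ℕ
  residueParts m = partSizes ℓ (part {m} ℓ) (λ _ → true)

  residueParts-balanced : ∀ m → Balanced (residueParts m)
  residueParts-balanced m i j with q , #≡ ← residueClassSize≡ m = begin
    residueParts m j                      ≡⟨ #≡ (toℕ j) (toℕ<n j) ⟩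
    q + indicator (toℕ j <ᵇ m % ℓ)        ≤⟨ +-monoʳ-≤ q (indicator≤1 _) ⟩
    q + 1                                 ≡⟨ +-comm q 1 ⟩
    suc q                                 ≤⟨ s≤s (m≤m+n q _) ⟩
    suc (q + indicator (toℕ i <ᵇ m % ℓ))  ≡⟨ cong suc (#≡ (toℕ i) (toℕ<n i)) ⟨
    suc (residueParts m i)                ∎
    where
    open ≤-Reasoning
    indicator≤1 : ∀ b → indicator b ≤ 1
    indicator≤1 true = ≤-refl
    indicator≤1 false = z≤n

  sum-residueParts : ∀ m → sum (residueParts m) ≡ m
  sum-residueParts m = trans (sum-partSizes {m} ℓ (part ℓ) (λ i → m%n<n (toℕ i) ℓ) (λ _ → true)) (count-all m)

balanced-exists : (ℓ m : ℕ) → (ℓ ≡ 0 → m ≡ 0) → ∃ λ (B : Fin ℓ → ℕ) → Balanced B × sum B ≡ m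
balanced-exists zero m m≡0 = (λ ()) , (λ ()) , sym (m≡0 refl)
balanced-exists (suc k) m _ = residueParts k m , residueParts-balanced k m , sum-residueParts k m

-- Zykov symmetrisation

module _ {n : ℕ} (G : Graph n) where

  -- Delete the k vertices of W outside A one at a time: the (s + 1)-cliques lost with a vertex u
  -- are u plus an s-clique of its neighbourhood.
  cliqueCount-peel : {U A : Fin n → Bool} (s M : ℕ) → (∀ {u} → T (U u) → cliqueCount G (U ∩ neighbours G u) s ≤ M) →
    ∀ k {W : Fin n → Bool} → count W ≡ k + count A →
    (∀ {x} → T (A x) → T (W x)) → (∀ {x} → T (W x) → T (U x)) →
    cliqueCount G W (suc s) ≤ cliqueCount G A (suc s) + k * M
  cliqueCount-peel {A = A} s M _ zero {W} |W|≡|A| A⊆W _ =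
    ≤-trans (cliqueCount-mono G (suc s) W⊆A) (≤-reflexive (sym (+-identityʳ _)))
    where
    W⊆A : ∀ {x} → T (W x) → T (A x)
    W⊆A {x} Wx with T? (A x)
    ... | yes Ax = Ax
    ... | no ¬Ax = ⊥-elim (<-irrefl (sym |W|≡|A|) (count-⊂ {A = A} {W} A⊆W Wx ¬Ax))
  cliqueCount-peel {A = A} s M bound (suc k) {W} |W|≡1+k+|A| A⊆W W⊆U
    with any? (λ x → T? (W x ∧ not (A x)))
  ... | no ∄x = ⊥-elim (<-irrefl refl (begin-strict
        count A          <⟨ s≤s (m≤n+m (count A) k) ⟩
        suc k + count A  ≡⟨ |W|≡1+k+|A| ⟨
        count W          ≤⟨ count-mono W⊆A ⟩
        count A          ∎))
    where
    open ≤-Reasoning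
    W⊆A : ∀ x → T (W x) → T (A x)
    W⊆A x Wx with T? (A x)
    ... | yes Ax = Ax
    ... | no ¬Ax = ⊥-elim (∄x (x , T-∧⁺ Wx (T-not⁺ ¬Ax)))
  ... | yes (u , Wu∧¬Au) = begin
    cliqueCount G W (suc s)
      ≡⟨ cliqueCount-remove G s Wu ⟩
    cliqueCount G (W ∖ u) (suc s) + cliqueCount G (W ∩ neighbours G u) s
      ≤⟨ +-mono-≤ (cliqueCount-peel s M bound k |W∖u|≡k+|A| A⊆W∖u (W⊆U ∘ T-∧⁻ˡ))
                  (≤-trans (cliqueCount-mono G s (λ {x} h → T-∧⁺ (W⊆U (T-∧⁻ˡ h)) (T-∧⁻ʳ {W x} h)))
                           (bound (W⊆U Wu))) ⟩
    (cliqueCount G A (suc s) + k * M) + M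
      ≡⟨ trans (+-assoc (cliqueCount G A (suc s)) (k * M) M)
               (cong (cliqueCount G A (suc s) +_) (+-comm (k * M) M)) ⟩
    cliqueCount G A (suc s) + suc k * M
      ∎
    where
    open ≤-Reasoning
    Wu : T (W u)
    Wu = T-∧⁻ˡ Wu∧¬Au
    ¬Au : ¬ T (A u)
    ¬Au = T-not⁻ (T-∧⁻ʳ {W u} Wu∧¬Au)
    |W∖u|≡k+|A| : count (W ∖ u) ≡ k + count A
    |W∖u|≡k+|A| = suc-injective (trans (sym (count-∖ W Wu)) |W|≡1+k+|A|)
    A⊆W∖u : ∀ {x} → T (A x) → T ((W ∖ u) x)
    A⊆W∖u {x} Ax = T-∧⁺ (A⊆W Ax) (≢⇒≟-false x u λ { refl → ¬Au Ax })

  -- Peel U down to the neighbourhood A of a vertex v maximising the s-cliques in its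
  -- neighbourhood; A is K_ℓ-free, and the resulting bound e_{s+1}(|U| - |A|, B′) is at most
  -- e_{s+1}(B) since B is balanced.
  cliqueCount-≤-esym : ∀ ℓ (U : Fin n → Bool) → cliqueCount G U (suc ℓ) ≡ 0 →
    ∀ s {B : Fin ℓ → ℕ} → Balanced B → sum B ≡ count U → cliqueCount G U s ≤ esym s B
  cliqueCount-≤-esym ℓ U free zero _ _ = ≤-reflexive (cliqueCount-0 G U)
  cliqueCount-≤-esym ℓ U free (suc s) {B} balanced ΣB≡|U|
    with argmax U (λ v → cliqueCount G (U ∩ neighbours G v) s)
  ... | inj₁ ∄v = ≤-trans (≤-reflexive (cliqueCount-empty G U s ∄v)) z≤n
  ... | inj₂ (v , Uv , max) with ℓ
  ...   | zero = ⊥-elim (0≢1+n (trans (sym free) (trans (cliqueCount-1 G U) (count-∖ U Uv))))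
  ...   | suc ℓ′ = bound (balanced-exists ℓ′ (count A) (λ { refl → trans (sym (cliqueCount-1 G A)) A-free }))
    where
    A = U ∩ neighbours G v
    |A|≤|U| : count A ≤ count U
    |A|≤|U| = count-mono (λ x → T-∧⁻ˡ {U x})
    b = count U ∸ count A
    A-free : cliqueCount G A (suc ℓ′) ≡ 0
    A-free = m+n≡0⇒n≡0 (cliqueCount G (U ∖ v) (suc (suc ℓ′)))
                       (trans (sym (cliqueCount-remove G (suc ℓ′) Uv)) free)
    bound : (∃ λ (B′ : Fin ℓ′ → ℕ) → Balanced B′ × sum B′ ≡ count A) → cliqueCount G U (suc s) ≤ esym (suc s) B
    bound (B′ , balanced′ , ΣB′≡|A|) = begin
      cliqueCount G U (suc s)
        ≤⟨ cliqueCount-peel s (cliqueCount G A s) max b (sym (m∸n+n≡m |A|≤|U|)) (λ {x} h → T-∧⁻ˡ {U x} h) id ⟩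
      cliqueCount G A (suc s) + b * cliqueCount G A s
        ≤⟨ +-mono-≤ (induction (suc s)) (*-monoʳ-≤ b (induction s)) ⟩
      esym (suc s) (b ∷ᶠ B′)
        ≤⟨ esym-≤-balanced (suc s) {P = b ∷ᶠ B′} balanced ΣbB′≡ΣB ⟩
      esym (suc s) B
        ∎
      where
      open ≤-Reasoning
      induction : ∀ s → cliqueCount G A s ≤ esym s B′
      induction s = cliqueCount-≤-esym ℓ′ A A-free s balanced′ ΣB′≡|A|
      ΣbB′≡ΣB : b + sum B′ ≡ sum B
      ΣbB′≡ΣB = trans (cong (b +_) ΣB′≡|A|) (trans (m∸n+n≡m |A|≤|U|) (sym ΣB≡|U|))

-- Shadows of hypergraphs

module _ {n r : ℕ} (H : RGraph n r) where

  edgeThrough : Fin n → Fin n → Subset n → Bool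
  edgeThrough x y A = (edge H A ∧ lookup A x) ∧ lookup A y

  shadow : Graph n
  shadow x y = anySubset (edgeThrough x y)

  spansClique⇒cliqueIn : {s : ℕ} {S : Subset n} → 2 ≤ r → r ≤ s →
    T (spansClique s H S) → CliqueIn shadow (λ _ → true) s S
  spansClique⇒cliqueIn {s} {S} 2≤r r≤s h = record { ⊆U = λ _ → tt ; size = ∣S∣≡s ; clique = clique }
    where
    ∣S∣≡s : ∣ S ∣ ≡ s
    ∣S∣≡s = ≡ᵇ⇒≡ ∣ S ∣ s (T-∧⁻ˡ h)
    clique : IsClique shadow S
    clique {x} {y} x∈S y∈S x≢y with B , xy⊆B , B⊆S , ∣B∣≡r ←
        ⊆-extend (pair x y) S r (pair⊆ x∈S y∈S) (≤-trans (≤-reflexive (∣pair∣≡2 x≢y)) 2≤r)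
                 (≤-trans r≤s (≤-reflexive (sym ∣S∣≡s)))
      = anySubset⁺ (edgeThrough x y) B (T-∧⁺ (T-∧⁺ B-edge (∈⇒T (xy⊆B (x∈pair x≢y)))) (∈⇒T (xy⊆B (y∈pair x y))))
      where
      B-edge : T (edge H B)
      B-edge = T-⇒ᵇ⁻ (T-all⁻ _ (T-∧⁻ʳ {∣ S ∣ ≡ᵇ s} h) (∈-allSubsets B))
                     (T-∧⁺ (⊆⇒⊆ᵇ B⊆S) (≡⇒≡ᵇ ∣ B ∣ r ∣B∣≡r))

  Covers : (Subset n → Bool) → Subset n → Set
  Covers F C = ∀ x y → x ∈ C → y ∈ C → x ≢ y → ∃ λ A → T (F A) × x ∈ A × y ∈ A

  PairCover : ℕ → Subset n → Set
  PairCover t C =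
    ∃ λ (F : Subset n → Bool) → (∀ A → T (F A) → T (edge H A)) × countSubsets F ≤ t choose 2 × Covers F C

  -- Adding a vertex x to a clique costs one chosen hyperedge for each pair {x, y}, and
  -- C(t, 2) + t = C(t + 1, 2).
  pairCover-insert : {t : ℕ} {C : Subset n} {x : Fin n} → x ∈ C → ∣ C [ x ]≔ outside ∣ ≡ t →
    IsClique shadow C → PairCover t (C [ x ]≔ outside) → PairCover (suc t) C
  pairCover-insert {t} {C} {x} x∈C ∣C′∣≡t clique (F′ , F′⊆H , ∣F′∣≤ , covers′) = F , F⊆H , ∣F∣≤ , covers
    where
    C′ = C [ x ]≔ outside
    chosen : Fin n → Subset n
    chosen y = firstSubset (edgeThrough x y)
    Fₓ : Subset n → Bool
    Fₓ A = edge H A ∧ anyFin (λ y → lookup C′ y ∧ does (A ≟ₛ chosen y))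
    F : Subset n → Bool
    F A = F′ A ∨ Fₓ A
    F⊆H : ∀ A → T (F A) → T (edge H A)
    F⊆H A h = [ F′⊆H A , T-∧⁻ˡ ]′ (T-∨⁻ {F′ A} h)
    ∣Fₓ∣≤t : countSubsets Fₓ ≤ t
    ∣Fₓ∣≤t = begin
      countSubsets Fₓ
        ≤⟨ countSubsets-mono (λ A → T-∧⁻ʳ {edge H A}) ⟩
      countSubsets (λ A → anyFin (λ y → lookup C′ y ∧ does (A ≟ₛ chosen y)))
        ≤⟨ countSubsets-anyFin (λ y A → lookup C′ y ∧ does (A ≟ₛ chosen y)) ⟩
      sum (λ y → countSubsets (λ A → lookup C′ y ∧ does (A ≟ₛ chosen y)))
        ≤⟨ sum-mono (λ y → countSubsets-≡-if (lookup C′ y) (chosen y)) ⟩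
      count (lookup C′)
        ≡⟨ trans (sym (∣p∣≡count C′)) ∣C′∣≡t ⟩
      t ∎
      where open ≤-Reasoning
    ∣F∣≤ : countSubsets F ≤ suc t choose 2
    ∣F∣≤ = begin
      countSubsets F                  ≤⟨ countSubsets-∨ F′ Fₓ ⟩
      countSubsets F′ + countSubsets Fₓ ≤⟨ +-mono-≤ ∣F′∣≤ ∣Fₓ∣≤t ⟩
      t choose 2 + t                  ≡⟨ +-comm _ t ⟩
      t + t choose 2                  ≡⟨ cong (_+ t choose 2) (nC1≡n t) ⟨
      t choose 1 + t choose 2         ≡⟨ nCk+nC[k+1]≡[n+1]C[k+1] t 1 ⟩
      suc t choose 2                  ∎
      where open ≤-Reasoning
    through-x : ∀ y → y ∈ C → x ≢ y → ∃ λ A → T (F A) × x ∈ A × y ∈ A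
    through-x y y∈C x≢y =
      chosen y , T-∨⁺ʳ {F′ (chosen y)} (T-∧⁺ (T-∧⁻ˡ (T-∧⁻ˡ edge-xy)) (anyFin⁺ _ y (T-∧⁺ (∈⇒T y∈C′) chosen≡chosen))) ,
      T⇒∈ (T-∧⁻ʳ {edge H (chosen y)} (T-∧⁻ˡ edge-xy)) , T⇒∈ (T-∧⁻ʳ {edge H (chosen y) ∧ _} edge-xy)
      where
      edge-xy : T (edgeThrough x y (chosen y))
      edge-xy = firstSubset-sound (edgeThrough x y) (clique x∈C y∈C x≢y)
      y∈C′ : y ∈ C′
      y∈C′ = ∈-[]≔⁺ (x≢y ∘ sym) y∈C
      chosen≡chosen : T (does (chosen y ≟ₛ chosen y))
      chosen≡chosen = Equivalence.from T-≡ (dec-true (chosen y ≟ₛ chosen y) refl)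
    covers : Covers F C
    covers y z y∈C z∈C y≢z with y ≟ x | z ≟ x
    ... | yes refl | yes refl = ⊥-elim (y≢z refl)
    ... | yes refl | no z≢x = through-x z z∈C y≢z
    ... | no y≢x | yes refl = let A , FA , x∈A , y∈A = through-x y y∈C (y≢z ∘ sym) in A , FA , y∈A , x∈A
    ... | no y≢x | no z≢x =
      let A , F′A , y∈A , z∈A = covers′ y z (∈-[]≔⁺ y≢x y∈C) (∈-[]≔⁺ z≢x z∈C) y≢z in A , T-∨⁺ˡ F′A , y∈A , z∈A

  pairCover : ∀ t (C : Subset n) → ∣ C ∣ ≡ t → IsClique shadow C → PairCover t C
  pairCover zero C ∣C∣≡0 _ =
    (λ _ → false) , (λ _ ()) , ≤-reflexive (countSubsets-none {n} (λ _ → false) (λ _ ())) ,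
    λ x _ x∈C → ⊥-elim (∣p∣≡0⇒Empty ∣C∣≡0 (x , x∈C))
  pairCover (suc t) C ∣C∣≡1+t clique =
    let x , x∈C = ∣p∣≢0⇒Nonempty {p = C} (λ ∣C∣≡0 → 0≢1+n (trans (sym ∣C∣≡0) ∣C∣≡1+t))
        ∣C′∣≡t = suc-injective (trans (∣p[x]≔outside∣ C x∈C) ∣C∣≡1+t)
    in pairCover-insert x∈C ∣C′∣≡t clique
         (pairCover t (C [ x ]≔ outside) ∣C′∣≡t (λ y∈ z∈ → clique (p[x]≔outside⊆p y∈) (p[x]≔outside⊆p z∈)))

  clique⇒ContainsKt : {t : ℕ} {C : Subset n} → ∣ C ∣ ≡ t → IsClique shadow C → ContainsKt t H
  clique⇒ContainsKt {t} {C} ∣C∣≡t clique =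
    let F , F⊆H , ∣F∣≤ , covers = pairCover t C ∣C∣≡t clique in F , F⊆H , ∣F∣≤ , C , ∣C∣≡t , covers

  shadow-free : (t : ℕ) → ¬ ContainsKt t H → cliqueCount shadow (λ _ → true) t ≡ 0
  shadow-free t ¬K = countSubsets-none (isCliqueIn shadow (λ _ → true) t) λ C h →
    let open CliqueIn (isCliqueIn⁻ h) in ¬K (clique⇒ContainsKt size clique)

-- The Turán hypergraph

module _ {n r : ℕ} (k : ℕ) where

  private
    ℓ = suc k
    turanGraph : Graph n
    turanGraph = multipartite (part ℓ)

  turan-edge⇒clique : {A : Subset n} → T (edge (turan n r ℓ) A) → IsClique turanGraph A
  turan-edge⇒clique {A} h = isClique⁻ (T-∧⁻ʳ {∣ A ∣ ≡ᵇ r} h)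

  cliqueIn⇒spansClique : {s : ℕ} {S : Subset n} →
    CliqueIn turanGraph (λ _ → true) s S → T (spansClique s (turan n r ℓ) S)
  cliqueIn⇒spansClique {s} {S} K = T-∧⁺ (≡⇒≡ᵇ ∣ S ∣ s size) (T-all⁺ _ (allSubsets n) λ B → T-⇒ᵇ⁺ λ h →
    let B⊆S = ⊆ᵇ⇒⊆ {p = B} {S} (T-∧⁻ˡ {B ⊆ᵇ S} h)
    in T-∧⁺ (T-∧⁻ʳ {B ⊆ᵇ S} h) (isClique⁺ (λ x∈B y∈B → clique (B⊆S x∈B) (B⊆S y∈B))))
    where open CliqueIn K

  cliqueCount-turanGraph : (s : ℕ) → cliqueCount turanGraph (λ _ → true) s ≡ esym s (residueParts k n)
  cliqueCount-turanGraph = cliqueCount-multipartite {n} (part ℓ) (λ i → m%n<n (toℕ i) ℓ) (λ _ → true)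

  turan-free : ¬ ContainsKt (ℓ + 1) (turan n r ℓ)
  turan-free (F , F⊆H , _ , S , ∣S∣≡ℓ+1 , covers) = <-irrefl refl (begin-strict
    0                                               <⟨ countSubsets-≥1 _ S (isCliqueIn⁺ S-clique) ⟩
    cliqueCount turanGraph (λ _ → true) (ℓ + 1)     ≡⟨ cliqueCount-turanGraph (ℓ + 1) ⟩
    esym (ℓ + 1) (residueParts k n)                 ≡⟨ esym-vanishes (ℓ + 1) (residueParts k n) (≤-reflexive (+-comm 1 ℓ)) ⟩
    0                                               ∎)
    where
    open ≤-Reasoning
    S-clique : CliqueIn turanGraph (λ _ → true) (ℓ + 1) S
    S-clique = record
      { ⊆U = λ _ → tt
      ; size = ∣S∣≡ℓ+1
      ; clique = λ {x} {y} x∈S y∈S x≢y → let A , FA , x∈A , y∈A = covers x y x∈S y∈S x≢y in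
          turan-edge⇒clique (F⊆H A FA) x∈A y∈A x≢y
      }

  numCliques-≤-turan : {s : ℕ} → 2 ≤ r → r ≤ s → (H : RGraph n r) → ¬ ContainsKt (ℓ + 1) H →
    numCliques s H ≤ numCliques s (turan n r ℓ)
  numCliques-≤-turan {s} 2≤r r≤s H ¬K = begin
    numCliques s H
      ≤⟨ countSubsets-mono {p = spansClique s H} (λ S h → isCliqueIn⁺ (spansClique⇒cliqueIn H {s} {S} 2≤r r≤s h)) ⟩
    cliqueCount (shadow H) (λ _ → true) s
      ≤⟨ cliqueCount-≤-esym (shadow H) ℓ (λ _ → true) shadow-free′ s (residueParts-balanced k n) Σparts≡n ⟩
    esym s (residueParts k n)
      ≡⟨ cliqueCount-turanGraph s ⟨
    cliqueCount turanGraph (λ _ → true) s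
      ≤⟨ countSubsets-mono {p = isCliqueIn turanGraph (λ _ → true) s}
                           (λ S h → cliqueIn⇒spansClique {s} {S} (isCliqueIn⁻ h)) ⟩
    numCliques s (turan n r ℓ)
      ∎
    where
    open ≤-Reasoning
    shadow-free′ : cliqueCount (shadow H) (λ _ → true) (suc ℓ) ≡ 0
    shadow-free′ = subst (λ t → cliqueCount (shadow H) (λ _ → true) t ≡ 0) (+-comm ℓ 1) (shadow-free H (ℓ + 1) ¬K)
    Σparts≡n : sum (residueParts k n) ≡ count {n} (λ _ → true)
    Σparts≡n = trans (sum-residueParts k n) (sym (count-all n))

corollary2p3 : (ℓ s r : ℕ) → 3 ≤ r → r ≤ s → s ≤ ℓ →
    ∃ λ (N : ℕ) → ∀ (n : ℕ) → N ≤ n →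
      IsEx r n s (ℓ + 1) (numCliques s (turan n r ℓ))
corollary2p3 zero s r 3≤r r≤s s≤0 with () ← ≤-trans 3≤r (≤-trans r≤s s≤0)
corollary2p3 (suc k) s r 3≤r r≤s _ = 0 , λ n _ →
  numCliques-≤-turan k (≤-trans (s≤s (s≤s z≤n)) 3≤r) r≤s , turan n r (suc k) , turan-free k , refl
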